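{- Let $q$ be an odd prime power, $\delta\in\mathbb{F}_{q^2}$ and $\gamma\in\mathbb{F}_q^*$. Then the polynomial $$f(x)=(x^q-x+\delta)^{q+3}+(x^q-x+\delta)^{q+2}+\gamma(x^q+x)$$ is a permutation polynomial of $\mathbb{F}_{q^2}$ if and only if either $q\equiv0\pmod 3$ and $\mathrm{Tr}_q^{q^2}(\delta)\neq2$, or $q\equiv2\pmod 3$ and $\mathrm{Tr}_q^{q^2}(\delta)=0$.
   Context: A polynomial over a finite field $\mathbb{F}$ is a permutation polynomial of $\mathbb{F}$ if the map it induces on $\mathbb{F}$ is a bijection. For $x\in\mathbb{F}_{q^2}$, $\mathrm{Tr}_q^{q^2}(x)=x+x^q$. -}

module Defs where

open import Level using (Level)
open import Data.Nat using (ℕ; _≥_)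
import Data.Nat
open import Data.Nat.Primality using (Prime)
open import Data.Fin using (Fin)
open import Data.Product using (Σ; ∃; _×_; _,_)
open import Relation.Nullary using (¬_)
open import Relation.Binary.PropositionalEquality using (_≡_)
open import Algebra.Bundles using (CommutativeRing)
import Algebra.Bundles
import Algebra.Definitions.RawSemiring as RS
open import Function.Definitions using (Injective; Surjective)

IsPrimePower : ℕ → Set
IsPrimePower q = Σ ℕ λ p → Σ ℕ λ k → Prime p × k ≥ 1 × q ≡ p Data.Nat.^ k

module _ {c ℓ : Level} (F : CommutativeRing c ℓ) where
  open CommutativeRing F
  open RS (Algebra.Bundles.Semiring.rawSemiring semiring) using (_^_)

  IsField : Set (c Level.⊔ ℓ)
  IsField = (¬ (1# ≈ 0#)) × (∀ x → ¬ (x ≈ 0#) → ∃ λ y → x * y ≈ 1#)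

  HasCard : ℕ → Set (c Level.⊔ ℓ)
  HasCard n = Σ (Fin n → Carrier) λ e → Injective _≡_ _≈_ e × Surjective _≡_ _≈_ e

  IsFiniteFieldOfOrder : ℕ → Set (c Level.⊔ ℓ)
  IsFiniteFieldOfOrder n = IsField × HasCard n

  IsPermutation : (Carrier → Carrier) → Set (c Level.⊔ ℓ)
  IsPermutation f = Injective _≈_ _≈_ f × Surjective _≈_ _≈_ f

  Tr : ℕ → Carrier → Carrier
  Tr q x = x + x ^ q

  InSubfield : ℕ → Carrier → Set ℓ
  InSubfield q x = x ^ q ≈ x

  two : Carrier
  two = 1# + 1#

  fPoly : ℕ → Carrier → Carrier → Carrier → Carrier
  fPoly q δ γ x =
    ((x ^ q - x + δ) ^ (q Data.Nat.+ 3)) + ((x ^ q - x + δ) ^ (q Data.Nat.+ 2)) + γ * (x ^ q + x)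

{-# OPTIONS --safe #-}
module Submission where

-- Let φ x = x ^ q, an involutive automorphism of F = F_{q²} with fixed field F_q, and put T = δ + φ δ,
-- a = T / 2. The coordinates u = φ x - x + δ - a (trace zero) and v = φ x + x (fixed by φ) determine x,
-- and in them f x = g u + γ v with g t = (a - t)(a + t)²(a + t + 1). As φ (f x) - f x = 2 (T + 1)(u³ - a² u),
-- f permutes F iff T ≠ -1 and u² + u w + w² = a² has no solution with u ≠ w on the trace-zero line.
-- In characteristic 3 that form is (u - w)², and for a = 0 and q ≡ 2 (mod 3) it forces u³ = w³, which on
-- the trace-zero line means u = w. Otherwise a primitive cube root of unity ω factors the form as
-- (u - ω w)(u - ω² w), and prescribing both factors (through a norm A φ(A) = - a² when q ≡ 2 (mod 3))
-- gives a solution with u ≠ w.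

open import Algebra.Bundles using (CommutativeRing; CommutativeMonoid)
open import Data.Empty using (⊥-elim)
open import Data.Fin.Base as Fin using (Fin; toℕ; fromℕ; inject₁; punchIn; punchOut)
import Data.Fin.Properties as Fin
open import Data.Fin.Permutation using (Permutation; permutation; _⟨$⟩ʳ_)
open import Data.Integer.Base as ℤ using (ℤ; +_; -[1+_]; _⊖_; sign; ∣_∣; _◃_)
import Data.Integer.Properties as ℤ
open import Data.List.Base using (List; []; _∷_; length; replicate; _++_)
import Data.List.Properties as List
open import Data.Maybe.Base using (Maybe; just; nothing)
open import Data.Nat.Base as ℕ using (ℕ; zero; suc; _<_; _≤_; z≤n; s≤s)
import Data.Nat.Properties as ℕ
open import Data.Nat.Combinatorics using (_C_; nCn≡1; nC1≡n; nCk+nC[k+1]≡[n+1]C[k+1])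
open import Data.Nat.Coprimality using (Coprime; coprime-Bézout)
open import Data.Nat.Divisibility using (_∣_; _∣?_; divides; ∣-refl; ∣⇒≤; n∣m*n; ∣1⇒≡1; m%n≡0⇒n∣m; n∣m⇒m%n≡0)
open import Data.Nat.DivMod using (_/_; _%_; m≡m%n+[m/n]*n; %-distribˡ-*; m%n<n)
open import Data.Nat.GCD using (module Bézout)
open import Data.Nat.Primality using (Prime; prime?; prime[2]; euclidsLemma; ¬prime[0]; ¬prime[1]; prime⇒nonZero; prime⇒irreducible)
open import Data.Nat.Tactic.RingSolver using (solve-∀)
open import Data.Product.Base using (∃; _,_; proj₁; proj₂) renaming (_×_ to _∧_)
open import Data.Sign.Base as Sign using (Sign)
open import Data.Sum.Base using (_⊎_; inj₁; inj₂; [_,_]′)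
open import Data.Unit.Base using (⊤)
open import Function.Base using (_∘_)
open import Function.Bundles using (_⇔_; mk⇔; Equivalence)
open import Function.Definitions using (Congruent; Injective; Surjective)
open import Level using (Level; _⊔_)
open import Relation.Binary.Core using (Rel)
open import Relation.Binary.Definitions using (Decidable)
open import Relation.Binary.PropositionalEquality as ≡ using (_≡_; _≢_)
open import Relation.Nullary.Decidable using (Dec; yes; no; toWitness)
open import Relation.Nullary.Negation using (¬_; contradiction)
open import Defs

-- Tactic.RingSolver takes its coefficients from the ring itself, so in an abstract ring it cannot see that
-- 1# - 1# ≈ 0#; here the coefficients are integers, interpreted by the canonical map ℤ → R.
module IntegerRingSolver {c ℓ} (R : CommutativeRing c ℓ) where
  open CommutativeRing R
  open import Algebra.Properties.Ring ring using (-0#≈0#; -‿involutive; -‿+-comm; -1*x≈-x)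
  open import Algebra.Properties.CommutativeSemigroup *-commutativeSemigroup using (interchange)
  open import Algebra.Properties.CommutativeSemigroup +-commutativeSemigroup using (x∙yz≈y∙xz)
  open import Algebra.Properties.Monoid.Mult.TCOptimised +-monoid using (_×_; 1+×; ×-homo-+)
  open import Algebra.Properties.Semiring.Mult.TCOptimised semiring using (×1-homo-*)
  open import Algebra.Solver.Ring.AlmostCommutativeRing using (_-Raw-AlmostCommutative⟶_; fromCommutativeRing)
  open import Relation.Binary.Reasoning.Setoid setoid

  ⟦_⟧ : ℤ → Carrier
  ⟦ + n ⟧ = n × 1#
  ⟦ -[1+ n ] ⟧ = - (suc n × 1#)

  ⟦-⟧ : ∀ i → ⟦ ℤ.- i ⟧ ≈ - ⟦ i ⟧
  ⟦-⟧ (+ zero) = sym -0#≈0#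
  ⟦-⟧ (+ suc n) = refl
  ⟦-⟧ -[1+ n ] = sym (-‿involutive _)

  ⟦⊖⟧+ : ∀ m n → ⟦ m ⊖ n ⟧ + n × 1# ≈ m × 1#
  ⟦⊖⟧+ m zero = +-identityʳ _
  ⟦⊖⟧+ zero (suc n) = -‿inverseˡ _
  ⟦⊖⟧+ (suc m) (suc n) = begin
    ⟦ suc m ⊖ suc n ⟧ + suc n × 1#   ≡⟨ ≡.cong (λ i → ⟦ i ⟧ + suc n × 1#) (ℤ.[1+m]⊖[1+n]≡m⊖n m n) ⟩
    ⟦ m ⊖ n ⟧ + suc n × 1#           ≈⟨ +-congˡ (1+× n 1#) ⟩
    ⟦ m ⊖ n ⟧ + (1# + n × 1#)        ≈⟨ x∙yz≈y∙xz _ _ _ ⟩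
    1# + (⟦ m ⊖ n ⟧ + n × 1#)        ≈⟨ +-congˡ (⟦⊖⟧+ m n) ⟩
    1# + m × 1#                      ≈⟨ 1+× m 1# ⟨
    suc m × 1#                       ∎

  ⟦⊖⟧ : ∀ m n → ⟦ m ⊖ n ⟧ ≈ m × 1# - n × 1#
  ⟦⊖⟧ m n = begin
    ⟦ m ⊖ n ⟧                         ≈⟨ +-identityʳ _ ⟨
    ⟦ m ⊖ n ⟧ + 0#                    ≈⟨ +-congˡ (-‿inverseʳ (n × 1#)) ⟨
    ⟦ m ⊖ n ⟧ + (n × 1# - n × 1#)     ≈⟨ +-assoc _ _ _ ⟨
    (⟦ m ⊖ n ⟧ + n × 1#) - n × 1#     ≈⟨ +-congʳ (⟦⊖⟧+ m n) ⟩
    m × 1# - n × 1#                   ∎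

  ⟦+⟧ : ∀ i j → ⟦ i ℤ.+ j ⟧ ≈ ⟦ i ⟧ + ⟦ j ⟧
  ⟦+⟧ (+ m) (+ n) = ×-homo-+ 1# m n
  ⟦+⟧ (+ m) -[1+ n ] = ⟦⊖⟧ m (suc n)
  ⟦+⟧ -[1+ m ] (+ n) = trans (⟦⊖⟧ n (suc m)) (+-comm _ _)
  ⟦+⟧ -[1+ m ] -[1+ n ] = begin
    - (suc (suc (m ℕ.+ n)) × 1#)          ≡⟨ ≡.cong (λ k → - (suc k × 1#)) (ℕ.+-suc m n) ⟨
    - ((suc m ℕ.+ suc n) × 1#)            ≈⟨ -‿cong (×-homo-+ 1# (suc m) (suc n)) ⟩
    - (suc m × 1# + suc n × 1#)           ≈⟨ -‿+-comm _ _ ⟨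
    - (suc m × 1#) + - (suc n × 1#)       ∎

  sgn : Sign → Carrier
  sgn Sign.+ = 1#
  sgn Sign.- = - 1#

  sgn-* : ∀ s t → sgn (s Sign.* t) ≈ sgn s * sgn t
  sgn-* Sign.+ t = sym (*-identityˡ _)
  sgn-* Sign.- Sign.+ = sym (*-identityʳ _)
  sgn-* Sign.- Sign.- = sym (trans (-1*x≈-x _) (-‿involutive 1#))

  ⟦◃⟧ : ∀ s n → ⟦ s ◃ n ⟧ ≈ sgn s * n × 1#
  ⟦◃⟧ Sign.+ n = trans (reflexive (≡.cong ⟦_⟧ (ℤ.+◃n≡+n n))) (sym (*-identityˡ _))
  ⟦◃⟧ Sign.- n = begin
    ⟦ Sign.- ◃ n ⟧      ≡⟨ ≡.cong ⟦_⟧ (ℤ.-◃n≡-n n) ⟩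
    ⟦ ℤ.- + n ⟧         ≈⟨ ⟦-⟧ (+ n) ⟩
    - (n × 1#)          ≈⟨ -1*x≈-x _ ⟨
    - 1# * n × 1#       ∎

  ⟦*⟧ : ∀ i j → ⟦ i ℤ.* j ⟧ ≈ ⟦ i ⟧ * ⟦ j ⟧
  ⟦*⟧ i j = begin
    ⟦ sign i Sign.* sign j ◃ ∣ i ∣ ℕ.* ∣ j ∣ ⟧               ≈⟨ ⟦◃⟧ (sign i Sign.* sign j) (∣ i ∣ ℕ.* ∣ j ∣) ⟩
    sgn (sign i Sign.* sign j) * (∣ i ∣ ℕ.* ∣ j ∣) × 1#     ≈⟨ *-cong (sgn-* (sign i) (sign j)) (×1-homo-* ∣ i ∣ ∣ j ∣) ⟩
    (sgn (sign i) * sgn (sign j)) * (∣ i ∣ × 1# * ∣ j ∣ × 1#) ≈⟨ interchange _ _ _ _ ⟩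
    (sgn (sign i) * ∣ i ∣ × 1#) * (sgn (sign j) * ∣ j ∣ × 1#) ≈⟨ *-cong (⟦sign◃abs⟧ i) (⟦sign◃abs⟧ j) ⟩
    ⟦ i ⟧ * ⟦ j ⟧                                           ∎
    where
    ⟦sign◃abs⟧ : ∀ k → sgn (sign k) * ∣ k ∣ × 1# ≈ ⟦ k ⟧
    ⟦sign◃abs⟧ k = trans (sym (⟦◃⟧ (sign k) ∣ k ∣)) (reflexive (≡.cong ⟦_⟧ (ℤ.◃-inverse k)))

  homomorphism : ℤ.+-*-rawRing -Raw-AlmostCommutative⟶ fromCommutativeRing R
  homomorphism = record
    { ⟦_⟧ = ⟦_⟧ ; +-homo = ⟦+⟧ ; *-homo = ⟦*⟧ ; -‿homo = ⟦-⟧ ; 0-homo = refl ; 1-homo = refl }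

  ⟦⟧-dec : ∀ i j → Maybe (⟦ i ⟧ ≈ ⟦ j ⟧)
  ⟦⟧-dec i j with i ℤ.≟ j
  ... | yes i≡j = just (reflexive (≡.cong ⟦_⟧ i≡j))
  ... | no _ = nothing

  open import Algebra.Solver.Ring ℤ.+-*-rawRing (fromCommutativeRing R) homomorphism ⟦⟧-dec public
    using (solve; _:=_; _:+_; _:*_; _:-_; :-_; _:^_; con)

[1+k]*[1+n]C[1+k]≡[1+n]*nCk : ∀ n k → suc k ℕ.* (suc n C suc k) ≡ suc n ℕ.* (n C k)
[1+k]*[1+n]C[1+k]≡[1+n]*nCk zero zero = ≡.refl
[1+k]*[1+n]C[1+k]≡[1+n]*nCk zero (suc k) = ℕ.*-zeroʳ (suc (suc k))
[1+k]*[1+n]C[1+k]≡[1+n]*nCk (suc n) zero = begin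
  1 ℕ.* (suc (suc n) C 1)   ≡⟨ ℕ.*-identityˡ _ ⟩
  suc (suc n) C 1           ≡⟨ nC1≡n (suc (suc n)) ⟩
  suc (suc n)               ≡⟨ ℕ.*-identityʳ _ ⟨
  suc (suc n) ℕ.* 1         ∎
  where open ≡.≡-Reasoning
[1+k]*[1+n]C[1+k]≡[1+n]*nCk (suc n) (suc k) = begin
  suc (suc k) ℕ.* (suc (suc n) C suc (suc k))
    ≡⟨ ≡.cong (suc (suc k) ℕ.*_) (nCk+nC[k+1]≡[n+1]C[k+1] (suc n) (suc k)) ⟨
  suc (suc k) ℕ.* (A ℕ.+ B)
    ≡⟨ ℕ.*-distribˡ-+ (suc (suc k)) A B ⟩
  (A ℕ.+ suc k ℕ.* A) ℕ.+ suc (suc k) ℕ.* B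
    ≡⟨ ℕ.+-assoc A _ _ ⟩
  A ℕ.+ (suc k ℕ.* A ℕ.+ suc (suc k) ℕ.* B)
    ≡⟨ ≡.cong₂ (λ u v → A ℕ.+ (u ℕ.+ v)) ([1+k]*[1+n]C[1+k]≡[1+n]*nCk n k) ([1+k]*[1+n]C[1+k]≡[1+n]*nCk n (suc k)) ⟩
  A ℕ.+ (suc n ℕ.* (n C k) ℕ.+ suc n ℕ.* (n C suc k))
    ≡⟨ ≡.cong (A ℕ.+_) (ℕ.*-distribˡ-+ (suc n) (n C k) (n C suc k)) ⟨
  A ℕ.+ suc n ℕ.* (n C k ℕ.+ n C suc k)
    ≡⟨ ≡.cong (λ u → A ℕ.+ suc n ℕ.* u) (nCk+nC[k+1]≡[n+1]C[k+1] n k) ⟩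
  suc (suc n) ℕ.* A ∎
  where
  open ≡.≡-Reasoning
  A = suc n C suc k
  B = suc n C suc (suc k)

p∣pCk : ∀ {p} k → Prime p → 0 < k → k < p → p ∣ p C k
p∣pCk {zero} k p-prime _ _ = contradiction p-prime ¬prime[0]
p∣pCk {suc n} (suc k) p-prime _ k<p
  with euclidsLemma (suc k) (suc n C suc k) p-prime
         (divides (n C k) (≡.trans ([1+k]*[1+n]C[1+k]≡[1+n]*nCk n k) (ℕ.*-comm (suc n) (n C k))))
... | inj₂ p∣[p]Ck = p∣[p]Ck
... | inj₁ p∣k = contradiction (∣⇒≤ p∣k) (ℕ.<⇒≱ k<p)

prime∣^⇒∣ : ∀ {n p} k → Prime n → n ∣ p ℕ.^ k → n ∣ p
prime∣^⇒∣ zero n-prime n∣1 = contradiction (≡.subst Prime (∣1⇒≡1 n∣1) n-prime) ¬prime[1]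
prime∣^⇒∣ {p = p} (suc k) n-prime n∣pᵏ⁺¹ with euclidsLemma p (p ℕ.^ k) n-prime n∣pᵏ⁺¹
... | inj₁ n∣p = n∣p
... | inj₂ n∣pᵏ = prime∣^⇒∣ k n-prime n∣pᵏ

prime∣prime⇒≡ : ∀ {n p} → Prime n → Prime p → n ∣ p → n ≡ p
prime∣prime⇒≡ n-prime p-prime n∣p with prime⇒irreducible p-prime n∣p
... | inj₁ ≡.refl = contradiction n-prime ¬prime[1]
... | inj₂ n≡p = n≡p

3∤n∧1+m≡n*n⇒3∣m : ∀ {n m} → ¬ 3 ∣ n → suc m ≡ n ℕ.* n → 3 ∣ m
3∤n∧1+m≡n*n⇒3∣m {n} {m} 3∤n 1+m≡n*n = divides (suc m / 3) (ℕ.suc-injective (begin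
  suc m                        ≡⟨ m≡m%n+[m/n]*n (suc m) 3 ⟩
  suc m % 3 ℕ.+ suc m / 3 ℕ.* 3 ≡⟨ ≡.cong (ℕ._+ suc m / 3 ℕ.* 3) [1+m]%3≡1 ⟩
  suc (suc m / 3 ℕ.* 3)        ∎))
  where
  open ≡.≡-Reasoning
  square%3 : ∀ r → r < 3 → r ≢ 0 → (r ℕ.* r) % 3 ≡ 1
  square%3 1 _ _ = ≡.refl
  square%3 2 _ _ = ≡.refl
  square%3 0 _ r≢0 = contradiction ≡.refl r≢0
  square%3 (suc (suc (suc _))) (s≤s (s≤s (s≤s ()))) _
  [1+m]%3≡1 : suc m % 3 ≡ 1
  [1+m]%3≡1 = begin
    suc m % 3                     ≡⟨ ≡.cong (_% 3) 1+m≡n*n ⟩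
    (n ℕ.* n) % 3                 ≡⟨ %-distribˡ-* n n 3 ⟩
    (n % 3 ℕ.* (n % 3)) % 3       ≡⟨ square%3 (n % 3) (m%n<n n 3) (3∤n ∘ m%n≡0⇒n∣m n 3) ⟩
    1                             ∎

module Multiples {c ℓ} (R : CommutativeRing c ℓ) where
  open CommutativeRing R
  open import Algebra.Properties.Semiring.Mult semiring public using (_×_)
  open import Algebra.Properties.Semiring.Mult semiring using (×-congʳ; ×-assoc-*; ×1-homo-*)
  open import Relation.Binary.Reasoning.Setoid setoid

  ×≈×1* : ∀ n x → n × x ≈ (n × 1#) * x
  ×≈×1* n x = trans (×-congʳ n (sym (*-identityˡ x))) (sym (×-assoc-* n 1# x))

  ×1≈0∧∣⇒×1≈0 : ∀ {d n} → d × 1# ≈ 0# → d ∣ n → n × 1# ≈ 0#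
  ×1≈0∧∣⇒×1≈0 {d} d×1≈0 (divides a ≡.refl) = begin
    (a ℕ.* d) × 1#        ≈⟨ ×1-homo-* a d ⟩
    (a × 1#) * (d × 1#)   ≈⟨ *-congˡ d×1≈0 ⟩
    (a × 1#) * 0#         ≈⟨ zeroʳ _ ⟩
    0#                    ∎

module PrimeCharacteristic {c ℓ} (R : CommutativeRing c ℓ) {p : ℕ} (p-prime : Prime p)
  (char : CommutativeRing._≈_ R (Multiples._×_ R p (CommutativeRing.1# R)) (CommutativeRing.0# R)) where
  open CommutativeRing R
  open Multiples R
  open import Algebra.Properties.Semiring.Exp semiring using (_^_; ^-congˡ; ^-assocʳ)
  open import Algebra.Properties.Semiring.Mult semiring using (×-homo-1; ×-homo-+)
  open import Algebra.Properties.Semiring.Sum semiring using (sum; sum-init-last; sum-cong-≋; sum-replicate-zero)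
  import Algebra.Properties.CommutativeSemiring.Binomial commutativeSemiring as Binomial
  open import Relation.Binary.Reasoning.Setoid setoid

  ∣⇒×≈0 : ∀ {n} x → p ∣ n → n × x ≈ 0#
  ∣⇒×≈0 {n} x p∣n = begin
    n × x               ≈⟨ ×≈×1* n x ⟩
    (n × 1#) * x        ≈⟨ *-congʳ (×1≈0∧∣⇒×1≈0 char p∣n) ⟩
    0# * x              ≈⟨ zeroˡ x ⟩
    0#                  ∎

  ×1≈0⇒p∣ : 1# ≉ 0# → ∀ {n} → n × 1# ≈ 0# → p ∣ n
  ×1≈0⇒p∣ 1≉0 {n} n×1≈0 with p ∣? n
  ... | yes p∣n = p∣n
  ... | no p∤n = contradiction (bézout (coprime-Bézout coprime)) 1≉0
    where
    coprime : Coprime p n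
    coprime (d∣p , d∣n) with prime⇒irreducible p-prime d∣p
    ... | inj₁ d≡1 = d≡1
    ... | inj₂ ≡.refl = contradiction d∣n p∤n
    1+a≡b⇒1≈0 : ∀ {a b} → 1 ℕ.+ a ≡ b → a × 1# ≈ 0# → b × 1# ≈ 0# → 1# ≈ 0#
    1+a≡b⇒1≈0 {a} ≡.refl a×1≈0 b×1≈0 = begin
      1#                   ≈⟨ +-identityʳ 1# ⟨
      1# + 0#              ≈⟨ +-congˡ a×1≈0 ⟨
      1# + a × 1#          ≈⟨ +-congʳ (×-homo-1 1#) ⟨
      1 × 1# + a × 1#      ≈⟨ ×-homo-+ 1# 1 a ⟨
      (1 ℕ.+ a) × 1#       ≈⟨ b×1≈0 ⟩
      0#                   ∎
    bézout : Bézout.Identity 1 p n → 1# ≈ 0#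
    bézout (Bézout.+- x y eq) = 1+a≡b⇒1≈0 eq (×1≈0∧∣⇒×1≈0 n×1≈0 (n∣m*n y)) (×1≈0∧∣⇒×1≈0 char (n∣m*n x))
    bézout (Bézout.-+ x y eq) = 1+a≡b⇒1≈0 eq (×1≈0∧∣⇒×1≈0 char (n∣m*n x)) (×1≈0∧∣⇒×1≈0 n×1≈0 (n∣m*n y))

  prime×1≈0⇒≡p : 1# ≉ 0# → ∀ {n} → Prime n → n × 1# ≈ 0# → n ≡ p
  prime×1≈0⇒≡p 1≉0 n-prime n×1≈0 with prime⇒irreducible n-prime (×1≈0⇒p∣ 1≉0 n×1≈0)
  ... | inj₁ ≡.refl = contradiction p-prime ¬prime[1]
  ... | inj₂ p≡n = ≡.sym p≡n

  private
    sum-first-last : ∀ {n} (t : Fin (suc (suc n)) → Carrier) → (∀ i → t (Fin.suc (inject₁ i)) ≈ 0#) →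
                     sum t ≈ t Fin.zero + t (fromℕ (suc n))
    sum-first-last {n} t inner = +-congˡ (begin
      sum (λ i → t (Fin.suc i))                                          ≈⟨ sum-init-last (λ i → t (Fin.suc i)) ⟩
      sum (λ i → t (Fin.suc (inject₁ i))) + t (fromℕ (suc n))            ≈⟨ +-congʳ (sum-cong-≋ inner) ⟩
      sum {n} (λ _ → 0#) + t (fromℕ (suc n))                             ≈⟨ +-congʳ (sum-replicate-zero n) ⟩
      0# + t (fromℕ (suc n))                                             ≈⟨ +-identityˡ _ ⟩
      t (fromℕ (suc n))                                                  ∎)

    ^[1+n]-homo-+ : ∀ n → suc n ≡ p → ∀ x y → (x + y) ^ suc n ≈ x ^ suc n + y ^ suc n
    ^[1+n]-homo-+ n ≡.refl x y = begin
      (x + y) ^ suc n                                      ≈⟨ Binomial.theorem (suc n) x y ⟩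
      Binomial.binomialExpansion x y (suc n)                ≈⟨ sum-first-last term inner-vanish ⟩
      term Fin.zero + term (fromℕ (suc n))                  ≈⟨ +-cong first last ⟩
      y ^ suc n + x ^ suc n                                ≈⟨ +-comm _ _ ⟩
      x ^ suc n + y ^ suc n                                ∎
      where
      term = Binomial.binomialTerm x y (suc n)
      first : term Fin.zero ≈ y ^ suc n
      first = trans (+-identityʳ _) (*-identityˡ _)
      last : term (fromℕ (suc n)) ≈ x ^ suc n
      last = begin
        (suc n C toℕ (fromℕ (suc n))) × (x ^ toℕ (fromℕ (suc n)) * y ^ (suc n ℕ.∸ toℕ (fromℕ (suc n))))
          ≡⟨ ≡.cong (λ j → (suc n C j) × (x ^ j * y ^ (suc n ℕ.∸ j))) (Fin.toℕ-fromℕ (suc n)) ⟩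
        (suc n C suc n) × (x ^ suc n * y ^ (suc n ℕ.∸ suc n))
          ≡⟨ ≡.cong₂ (λ a b → a × (x ^ suc n * y ^ b)) (nCn≡1 (suc n)) (ℕ.n∸n≡0 (suc n)) ⟩
        1 × (x ^ suc n * 1#)                                ≈⟨ ×-homo-1 _ ⟩
        x ^ suc n * 1#                                      ≈⟨ *-identityʳ _ ⟩
        x ^ suc n                                           ∎
      inner-vanish : ∀ i → term (Fin.suc (inject₁ i)) ≈ 0#
      inner-vanish i = ∣⇒×≈0 _ (p∣pCk (suc (toℕ (inject₁ i))) p-prime (s≤s z≤n)
                                (s≤s (≡.subst (_< n) (≡.sym (Fin.toℕ-inject₁ i)) (Fin.toℕ<n i))))

  ^p-homo-+ : ∀ x y → (x + y) ^ p ≈ x ^ p + y ^ p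
  ^p-homo-+ = ≡.subst (λ n → ∀ x y → (x + y) ^ n ≈ x ^ n + y ^ n) p-pred
                (^[1+n]-homo-+ (ℕ.pred p) p-pred)
    where
    p-pred : suc (ℕ.pred p) ≡ p
    p-pred = ℕ.suc-pred p {{prime⇒nonZero p-prime}}

  ^[p^k]-homo-+ : ∀ k x y → (x + y) ^ (p ℕ.^ k) ≈ x ^ (p ℕ.^ k) + y ^ (p ℕ.^ k)
  ^[p^k]-homo-+ zero x y = trans (*-identityʳ _) (+-cong (sym (*-identityʳ x)) (sym (*-identityʳ y)))
  ^[p^k]-homo-+ (suc k) x y = begin
    (x + y) ^ (p ℕ.* p ℕ.^ k)            ≈⟨ ^-assocʳ _ p (p ℕ.^ k) ⟨
    ((x + y) ^ p) ^ (p ℕ.^ k)            ≈⟨ ^-congˡ (p ℕ.^ k) (^p-homo-+ x y) ⟩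
    (x ^ p + y ^ p) ^ (p ℕ.^ k)          ≈⟨ ^[p^k]-homo-+ k _ _ ⟩
    (x ^ p) ^ (p ℕ.^ k) + (y ^ p) ^ (p ℕ.^ k) ≈⟨ +-cong (^-assocʳ x p _) (^-assocʳ y p _) ⟩
    x ^ (p ℕ.* p ℕ.^ k) + y ^ (p ℕ.* p ℕ.^ k) ∎

module MonicPolynomial {c ℓ} (R : CommutativeRing c ℓ) where
  open CommutativeRing R
  open import Algebra.Properties.Semiring.Exp semiring using (_^_)
  open import Relation.Binary.Reasoning.Setoid setoid
  open IntegerRingSolver R using (solve; _:=_; _:+_; _:*_; _:-_; con)

  -- monic [a₀, …, aₙ₋₁] x = a₀ + a₁ x + ⋯ + aₙ₋₁ xⁿ⁻¹ + xⁿ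
  monic : List Carrier → Carrier → Carrier
  monic [] x = 1#
  monic (a ∷ as) x = a + x * monic as x

  quotient : Carrier → List Carrier → List Carrier
  quotient r [] = []
  quotient r (a ∷ []) = []
  quotient r (a ∷ b ∷ as) = monic (b ∷ as) r ∷ quotient r (b ∷ as)

  length-quotient : ∀ r a as → length (quotient r (a ∷ as)) ≡ length as
  length-quotient r a [] = ≡.refl
  length-quotient r a (b ∷ as) = ≡.cong suc (length-quotient r b as)

  monic-division : ∀ r a as x → monic (a ∷ as) x ≈ (x - r) * monic (quotient r (a ∷ as)) x + monic (a ∷ as) r
  monic-division r a [] x =
    solve 3 (λ a x r → a :+ x :* con (+ 1) := (x :- r) :* con (+ 1) :+ (a :+ r :* con (+ 1))) refl a x r
  monic-division r a (b ∷ as) x = begin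
    a + x * monic (b ∷ as) x              ≈⟨ +-congˡ (*-congˡ (monic-division r b as x)) ⟩
    a + x * ((x - r) * Q + P)             ≈⟨ solve 5 (λ a x r Q P → a :+ x :* ((x :- r) :* Q :+ P)
                                                      := (x :- r) :* (P :+ x :* Q) :+ (a :+ r :* P)) refl a x r Q P ⟩
    (x - r) * (P + x * Q) + (a + r * P)   ∎
    where
    Q = monic (quotient r (b ∷ as)) x
    P = monic (b ∷ as) r

  monic-zeros : ∀ d x → monic (replicate d 0#) x ≈ x ^ d
  monic-zeros zero x = refl
  monic-zeros (suc d) x = trans (+-identityˡ _) (*-congˡ (monic-zeros d x))

  monic-pow : ∀ d a x → monic (- a ∷ replicate d 0#) x ≈ x ^ suc d - a
  monic-pow d a x = trans (+-congˡ (*-congˡ (monic-zeros d x))) (+-comm _ _)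

  monic-shift : ∀ n as x → monic (replicate n 0# ++ as) x ≈ x ^ n * monic as x
  monic-shift zero as x = sym (*-identityˡ _)
  monic-shift (suc n) as x = begin
    0# + x * monic (replicate n 0# ++ as) x   ≈⟨ +-identityˡ _ ⟩
    x * monic (replicate n 0# ++ as) x        ≈⟨ *-congˡ (monic-shift n as x) ⟩
    x * (x ^ n * monic as x)                  ≈⟨ *-assoc _ _ _ ⟨
    x * x ^ n * monic as x                    ∎

  atPower : ℕ → List Carrier → List Carrier
  atPower s [] = []
  atPower s (a ∷ as) = a ∷ (replicate s 0# ++ atPower s as)

  length-atPower : ∀ s as → length (atPower s as) ≡ suc s ℕ.* length as
  length-atPower s [] = ≡.sym (ℕ.*-zeroʳ s)
  length-atPower s (a ∷ as) =
    ≡.trans (≡.cong suc (List.length-++ (replicate s 0#)))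
    (≡.trans (≡.cong₂ (λ u v → suc (u ℕ.+ v)) (List.length-replicate s) (length-atPower s as))
             (arithmetic s (length as)))
    where
    arithmetic : ∀ s n → suc (s ℕ.+ suc s ℕ.* n) ≡ suc s ℕ.* suc n
    arithmetic = solve-∀

  monic-atPower : ∀ s as x → monic (atPower s as) x ≈ monic as (x ^ suc s)
  monic-atPower s [] x = refl
  monic-atPower s (a ∷ as) x = +-congˡ (begin
    x * monic (replicate s 0# ++ atPower s as) x   ≈⟨ *-congˡ (monic-shift s _ x) ⟩
    x * (x ^ s * monic (atPower s as) x)           ≈⟨ *-assoc _ _ _ ⟨
    x ^ suc s * monic (atPower s as) x             ≈⟨ *-congˡ (monic-atPower s as x) ⟩
    x ^ suc s * monic as (x ^ suc s)               ∎)

  geometric : Carrier → ℕ → List Carrier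
  geometric a zero = []
  geometric a (suc k) = a ^ suc k ∷ geometric a k

  length-geometric : ∀ a k → length (geometric a k) ≡ k
  length-geometric a zero = ≡.refl
  length-geometric a (suc k) = ≡.cong suc (length-geometric a k)

  monic-geometric : ∀ a k y → (y - a) * monic (geometric a k) y ≈ y ^ suc k - a ^ suc k
  monic-geometric a zero y = solve 2 (λ y a → (y :- a) :* con (+ 1) := y :* con (+ 1) :- a :* con (+ 1)) refl y a
  monic-geometric a (suc k) y = begin
    (y - a) * (b + y * G)              ≈⟨ solve 4 (λ y a b G → (y :- a) :* (b :+ y :* G) := (y :- a) :* b :+ y :* ((y :- a) :* G)) refl y a b G ⟩
    (y - a) * b + y * ((y - a) * G)    ≈⟨ +-congˡ (*-congˡ (monic-geometric a k y)) ⟩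
    (y - a) * b + y * (yᵏ - b)         ≈⟨ solve 4 (λ y a b Y → (y :- a) :* b :+ y :* (Y :- b) := y :* Y :- a :* b) refl y a b yᵏ ⟩
    y * yᵏ - a * b                     ∎
    where
    b = a ^ suc k
    G = monic (geometric a k) y
    yᵏ = y ^ suc k

record Enumeration {a ℓ p} {A : Set a} (_≈_ : Rel A ℓ) (k : ℕ) (P : A → Set p) : Set (a ⊔ ℓ ⊔ p) where
  field
    elem : Fin k → A
    elem-injective : ∀ {i j} → elem i ≈ elem j → i ≡ j
    elem-satisfies : ∀ i → P (elem i)
    index : ∀ x → P x → Fin k
    elem-index : ∀ x (px : P x) → elem (index x px) ≈ x

module _ {c ℓ} (M : CommutativeMonoid c ℓ) where
  open CommutativeMonoid M
  open import Algebra.Properties.CommutativeMonoid.Sum M using (sum; sum-replicate; ∑-distrib-+; ∑-permute; sum-cong-≋)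
  open import Algebra.Properties.Monoid.Mult monoid using (_×_)
  open import Relation.Binary.Reasoning.Setoid setoid

  ∑-translation-invariant : ∀ {k p} {P : Carrier → Set p} (E : Enumeration _≈_ k P) {a a⁻} →
    a⁻ ∙ a ≈ ε → (∀ {x} → P x → P (a ∙ x)) → (∀ {x} → P x → P (a⁻ ∙ x)) →
    (k × a) ∙ sum (Enumeration.elem E) ≈ sum (Enumeration.elem E)
  ∑-translation-invariant {k} {P = P} E {a} {a⁻} a⁻a≈ε a-closed a⁻-closed = begin
    (k × a) ∙ sum elem                ≈⟨ ∙-congʳ (sum-replicate k) ⟨
    sum {k} (λ _ → a) ∙ sum elem      ≈⟨ ∑-distrib-+ (λ _ → a) elem ⟨
    sum (λ i → a ∙ elem i)            ≈⟨ sum-cong-≋ (λ i → sym (elem-index (a ∙ elem i) (a-closed (elem-satisfies i)))) ⟩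
    sum (λ i → elem (π ⟨$⟩ʳ i))        ≈⟨ ∑-permute elem π ⟨
    sum elem                          ∎
    where
    open Enumeration E
    translate : ∀ {b} → (∀ {x} → P x → P (b ∙ x)) → Fin k → Fin k
    translate {b} closed i = index (b ∙ elem i) (closed (elem-satisfies i))
    cancel : ∀ {b b⁻} → b⁻ ∙ b ≈ ε → ∀ x → b⁻ ∙ (b ∙ x) ≈ x
    cancel {b} {b⁻} inv x = trans (sym (assoc b⁻ b x)) (trans (∙-congʳ inv) (identityˡ x))
    translate-inverse : ∀ {b b⁻} (inv : b⁻ ∙ b ≈ ε) (b-closed : ∀ {x} → P x → P (b ∙ x)) (b⁻-closed : ∀ {x} → P x → P (b⁻ ∙ x)) →
                        ∀ i → translate b⁻-closed (translate b-closed i) ≡ i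
    translate-inverse {b} {b⁻} inv b-closed b⁻-closed i = elem-injective (begin
      elem (translate b⁻-closed (translate b-closed i))  ≈⟨ elem-index _ _ ⟩
      b⁻ ∙ elem (translate b-closed i)                   ≈⟨ ∙-congˡ (elem-index _ _) ⟩
      b⁻ ∙ (b ∙ elem i)                                  ≈⟨ cancel inv (elem i) ⟩
      elem i                                             ∎)
    aa⁻≈ε : a ∙ a⁻ ≈ ε
    aa⁻≈ε = trans (comm a a⁻) a⁻a≈ε
    π : Permutation k k
    π = permutation (translate a-closed) (translate a⁻-closed)
          (translate-inverse aa⁻≈ε a⁻-closed a-closed) (translate-inverse a⁻a≈ε a-closed a⁻-closed)

module FiniteField {c ℓ} (F : CommutativeRing c ℓ) (isField : IsField F) {m : ℕ} (card : HasCard F (suc m)) where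
  open CommutativeRing F
  open import Algebra.Properties.Ring ring using (x∙y⁻¹≈ε⇒x≈y; x≈y⇒x∙y⁻¹≈ε; +-identityˡ-unique; x[y-z]≈xy-xz)
  open import Algebra.Properties.Semiring.Exp semiring using (_^_)
  open import Algebra.Properties.Semiring.Mult semiring using (_×_; ×1-homo-*)
  open import Relation.Binary.Reasoning.Setoid setoid
  open MonicPolynomial F

  private
    e : Fin (suc m) → Carrier
    e = proj₁ card

    e-injective : ∀ {i j} → e i ≈ e j → i ≡ j
    e-injective = proj₁ (proj₂ card)

    index : Carrier → Fin (suc m)
    index x = proj₁ (proj₂ (proj₂ card) x)

    e-index : ∀ x → e (index x) ≈ x
    e-index x = proj₂ (proj₂ (proj₂ card) x) ≡.refl

  infix 4 _≟_
  _≟_ : Decidable _≈_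
  x ≟ y with index x Fin.≟ index y
  ... | yes i≡j = yes (trans (sym (e-index x)) (trans (reflexive (≡.cong e i≡j)) (e-index y)))
  ... | no i≢j = no (λ x≈y → i≢j (e-injective (trans (e-index x) (trans x≈y (sym (e-index y))))))

  1≉0 : 1# ≉ 0#
  1≉0 = proj₁ isField

  inverse : ∀ x → x ≉ 0# → Carrier
  inverse x x≉0 = proj₁ (proj₂ isField x x≉0)

  *-inverseʳ : ∀ x (x≉0 : x ≉ 0#) → x * inverse x x≉0 ≈ 1#
  *-inverseʳ x x≉0 = proj₂ (proj₂ isField x x≉0)

  *-inverseˡ : ∀ x (x≉0 : x ≉ 0#) → inverse x x≉0 * x ≈ 1#
  *-inverseˡ x x≉0 = trans (*-comm _ x) (*-inverseʳ x x≉0)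

  x≉0∧x*y≈0⇒y≈0 : ∀ {x y} → x ≉ 0# → x * y ≈ 0# → y ≈ 0#
  x≉0∧x*y≈0⇒y≈0 {x} {y} x≉0 xy≈0 = begin
    y                          ≈⟨ *-identityˡ y ⟨
    1# * y                     ≈⟨ *-congʳ (*-inverseˡ x x≉0) ⟨
    (inverse x x≉0 * x) * y    ≈⟨ *-assoc _ x y ⟩
    inverse x x≉0 * (x * y)    ≈⟨ *-congˡ xy≈0 ⟩
    inverse x x≉0 * 0#         ≈⟨ zeroʳ _ ⟩
    0#                         ∎

  *-≉0 : ∀ {x y} → x ≉ 0# → y ≉ 0# → x * y ≉ 0#
  *-≉0 x≉0 y≉0 xy≈0 = y≉0 (x≉0∧x*y≈0⇒y≈0 x≉0 xy≈0)

  x*y≈0⇒x≈0⊎y≈0 : ∀ {x y} → x * y ≈ 0# → x ≈ 0# ⊎ y ≈ 0#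
  x*y≈0⇒x≈0⊎y≈0 {x} xy≈0 with x ≟ 0#
  ... | yes x≈0 = inj₁ x≈0
  ... | no x≉0 = inj₂ (x≉0∧x*y≈0⇒y≈0 x≉0 xy≈0)

  *-cancelˡ : ∀ {x y z} → x ≉ 0# → x * y ≈ x * z → y ≈ z
  *-cancelˡ {x} {y} {z} x≉0 xy≈xz =
    x∙y⁻¹≈ε⇒x≈y y z (x≉0∧x*y≈0⇒y≈0 x≉0 (trans (x[y-z]≈xy-xz x y z) (x≈y⇒x∙y⁻¹≈ε xy≈xz)))

  inverse-unique : ∀ {x y} (x≉0 : x ≉ 0#) → x * y ≈ 1# → y ≈ inverse x x≉0
  inverse-unique {x} x≉0 xy≈1 = *-cancelˡ x≉0 (trans xy≈1 (sym (*-inverseʳ x x≉0)))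

  inverse-≉0 : ∀ {x} (x≉0 : x ≉ 0#) → inverse x x≉0 ≉ 0#
  inverse-≉0 {x} x≉0 x⁻¹≈0 = 1≉0 (trans (sym (*-inverseʳ x x≉0)) (trans (*-congˡ x⁻¹≈0) (zeroʳ x)))

  ^-≉0 : ∀ {x} n → x ≉ 0# → x ^ n ≉ 0#
  ^-≉0 zero x≉0 = 1≉0
  ^-≉0 (suc n) x≉0 = *-≉0 x≉0 (^-≉0 n x≉0)

  x^n≈0⇒x≈0 : ∀ {x} n → x ^ n ≈ 0# → x ≈ 0#
  x^n≈0⇒x≈0 {x} n xⁿ≈0 with x ≟ 0#
  ... | yes x≈0 = x≈0
  ... | no x≉0 = contradiction xⁿ≈0 (^-≉0 n x≉0)

  allElements : Enumeration _≈_ (suc m) (λ _ → ⊤)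
  allElements = record
    { elem = e ; elem-injective = e-injective ; elem-satisfies = _
    ; index = λ x _ → index x ; elem-index = λ x _ → e-index x }

  nonzeroElements : Enumeration _≈_ m (_≉ 0#)
  nonzeroElements = record
    { elem = λ i → e (punchIn i₀ i)
    ; elem-injective = λ eq → Fin.punchIn-injective i₀ _ _ (e-injective eq)
    ; elem-satisfies = λ i eq → Fin.punchInᵢ≢i i₀ i (e-injective (trans eq (sym (e-index 0#))))
    ; index = λ x x≉0 → punchOut (index≢i₀ x≉0)
    ; elem-index = λ x x≉0 → trans (reflexive (≡.cong e (Fin.punchIn-punchOut (index≢i₀ x≉0)))) (e-index x)
    }
    where
    i₀ = index 0#
    index≢i₀ : ∀ {x} → x ≉ 0# → i₀ ≢ index x
    index≢i₀ {x} x≉0 eq = x≉0 (trans (sym (e-index x)) (trans (reflexive (≡.cong e (≡.sym eq))) (e-index 0#)))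

  [1+m]×x≈0 : ∀ x → suc m × x ≈ 0#
  [1+m]×x≈0 x = +-identityˡ-unique _ _
    (∑-translation-invariant +-commutativeMonoid allElements (-‿inverseˡ x) _ _)

  x^m≈1 : ∀ {x} → x ≉ 0# → x ^ m ≈ 1#
  x^m≈1 {x} x≉0 = *-cancelˡ (∏-≉0 elem elem-satisfies) (begin
    ∏ elem * x ^ m     ≈⟨ *-comm _ _ ⟩
    x ^ m * ∏ elem     ≈⟨ ∑-translation-invariant *-commutativeMonoid nonzeroElements
                            (*-inverseˡ x x≉0) (*-≉0 x≉0) (*-≉0 (inverse-≉0 x≉0)) ⟩
    ∏ elem             ≈⟨ *-identityʳ _ ⟨
    ∏ elem * 1#        ∎)
    where
    open Enumeration nonzeroElements
    open import Algebra.Properties.Monoid.Sum *-monoid using () renaming (sum to ∏)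
    ∏-≉0 : ∀ {k} (f : Fin k → Carrier) → (∀ i → f i ≉ 0#) → ∏ f ≉ 0#
    ∏-≉0 {zero} f f≉0 = 1≉0
    ∏-≉0 {suc k} f f≉0 = *-≉0 (f≉0 Fin.zero) (∏-≉0 (f ∘ Fin.suc) (f≉0 ∘ Fin.suc))

  x^[1+m]≈x : ∀ x → x ^ suc m ≈ x
  x^[1+m]≈x x with x ≟ 0#
  ... | yes x≈0 = trans (*-congʳ x≈0) (trans (zeroˡ _) (sym x≈0))
  ... | no x≉0 = trans (*-congˡ (x^m≈1 x≉0)) (*-identityʳ x)

  injective⇒surjective : ∀ {f : Carrier → Carrier} → Congruent _≈_ _≈_ f →
                         Injective _≈_ _≈_ f → Surjective _≈_ _≈_ f
  injective⇒surjective {f} f-cong f-injective y with Fin.any? (λ i → index (f (e i)) Fin.≟ index y)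
  ... | yes (i , fi≡y) = e i , λ z≈ei → trans (f-cong z≈ei)
                           (trans (sym (e-index _)) (trans (reflexive (≡.cong e fi≡y)) (e-index y)))
  ... | no ∄i = contradiction (Fin.injective⇒≤ τ-injective) (ℕ.<-irrefl ≡.refl)
    where
    misses-y : ∀ i → index y ≢ index (f (e i))
    misses-y i eq = ∄i (i , ≡.sym eq)
    τ : Fin (suc m) → Fin m
    τ i = punchOut (misses-y i)
    τ-injective : ∀ {i j} → τ i ≡ τ j → i ≡ j
    τ-injective {i} {j} eq = e-injective (f-injective (begin
      f (e i)                ≈⟨ e-index _ ⟨
      e (index (f (e i)))    ≡⟨ ≡.cong e (Fin.punchOut-injective (misses-y i) (misses-y j) eq) ⟩
      e (index (f (e j)))    ≈⟨ e-index _ ⟩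
      f (e j)                ∎))

  roots≤degree : ∀ {k} as (g : Fin k → Carrier) → (∀ {i j} → g i ≈ g j → i ≡ j) →
                 (∀ i → monic as (g i) ≈ 0#) → k ≤ length as
  roots≤degree {zero} as g g-injective roots = z≤n
  roots≤degree {suc k} [] g g-injective roots = contradiction (roots Fin.zero) 1≉0
  roots≤degree {suc k} (a ∷ as) g g-injective roots =
    s≤s (≡.subst (k ≤_) (length-quotient r a as)
          (roots≤degree (quotient r (a ∷ as)) (g ∘ Fin.suc) (Fin.suc-injective ∘ g-injective) quotient-roots))
    where
    r = g Fin.zero
    quotient-roots : ∀ i → monic (quotient r (a ∷ as)) (g (Fin.suc i)) ≈ 0#
    quotient-roots i = x≉0∧x*y≈0⇒y≈0 gi-r≉0 (begin
      (gᵢ - r) * monic (quotient r (a ∷ as)) gᵢ                           ≈⟨ +-identityʳ _ ⟨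
      (gᵢ - r) * monic (quotient r (a ∷ as)) gᵢ + 0#                      ≈⟨ +-congˡ (roots Fin.zero) ⟨
      (gᵢ - r) * monic (quotient r (a ∷ as)) gᵢ + monic (a ∷ as) r        ≈⟨ monic-division r a as gᵢ ⟨
      monic (a ∷ as) gᵢ                                                   ≈⟨ roots (Fin.suc i) ⟩
      0#                                                                  ∎)
      where
      gᵢ = g (Fin.suc i)
      gi-r≉0 : gᵢ - r ≉ 0#
      gi-r≉0 gᵢ-r≈0 with g-injective (x∙y⁻¹≈ε⇒x≈y gᵢ r gᵢ-r≈0)
      ... | ()

  ∃-nonroot : ∀ as → length as < m → ∃ λ z → z ≉ 0# ∧ monic as z ≉ 0#
  ∃-nonroot as deg<m =
    let i , nonroot = Fin.¬∀⟶∃¬ m (λ i → monic as (elem i) ≈ 0#) (λ i → monic as (elem i) ≟ 0#)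
                        (λ allRoots → ℕ.<⇒≱ deg<m (roots≤degree as elem elem-injective allRoots))
    in elem i , elem-satisfies i , nonroot
    where open Enumeration nonzeroElements

  ∃-x^[1+d]≉1 : ∀ d → suc d < m → ∃ λ z → z ≉ 0# ∧ z ^ suc d ≉ 1#
  ∃-x^[1+d]≉1 d 1+d<m =
    let z , z≉0 , nonroot = ∃-nonroot (- 1# ∷ replicate d 0#) (≡.subst (_< m) (≡.cong suc (≡.sym (List.length-replicate d))) 1+d<m)
    in z , z≉0 , λ zᵈ⁺¹≈1 → nonroot (trans (monic-pow d 1# z) (x≈y⇒x∙y⁻¹≈ε zᵈ⁺¹≈1))

  card≡pʲ⇒p×1≈0 : ∀ {p j} → suc m ≡ p ℕ.^ j → p × 1# ≈ 0#
  card≡pʲ⇒p×1≈0 {p} {j} card≡pʲ = x^n≈0⇒x≈0 j (begin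
    (p × 1#) ^ j      ≈⟨ pʲ×1≈[p×1]ʲ j ⟨
    (p ℕ.^ j) × 1#    ≡⟨ ≡.cong (_× 1#) card≡pʲ ⟨
    suc m × 1#        ≈⟨ [1+m]×x≈0 1# ⟩
    0#                ∎)
    where
    pʲ×1≈[p×1]ʲ : ∀ j → (p ℕ.^ j) × 1# ≈ (p × 1#) ^ j
    pʲ×1≈[p×1]ʲ zero = +-identityʳ 1#
    pʲ×1≈[p×1]ʲ (suc j) = trans (×1-homo-* p (p ℕ.^ j)) (*-congˡ (pʲ×1≈[p×1]ʲ j))

-- q = 2 + r, so that q ≥ 2 holds by construction
module QuadraticExtension {c ℓ} (F : CommutativeRing c ℓ) (isField : IsField F)
  (r : ℕ) {p k : ℕ} (p-prime : Prime p) (q≡pᵏ : suc (suc r) ≡ p ℕ.^ k) (q-odd : suc (suc r) % 2 ≡ 1)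
  (card : HasCard F (suc (suc r) ℕ.* suc (suc r))) where

  open CommutativeRing F
  open import Algebra.Properties.Ring ring
    using (-0#≈0#; -‿involutive; -‿distribˡ-*; -‿distribʳ-*; -‿+-comm; x∙y⁻¹≈ε⇒x≈y; x≈y⇒x∙y⁻¹≈ε; +-inverseʳ-unique; +-inverseˡ-unique; +-cancelˡ)
  open import Algebra.Properties.Semiring.Exp semiring using (_^_; ^-congˡ; ^-homo-*; ^-assocʳ)
  open import Algebra.Properties.CommutativeSemiring.Exp commutativeSemiring using (^-distrib-*)
  open import Algebra.Properties.Semiring.Mult semiring using (_×_)
  open import Algebra.Properties.Monoid.Mult.TCOptimised +-monoid using (×ᵤ≈×)
  open import Relation.Binary.Reasoning.Setoid setoid
  open IntegerRingSolver F using (solve; _:=_; _:+_; _:*_; _:-_; :-_; _:^_; con)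
  open FiniteField F isField card
  open MonicPolynomial F

  q : ℕ
  q = suc (suc r)

  -- definitionally the solver's con (+ 2) and con (+ 3)
  2# 3# : Carrier
  2# = 1# + 1#
  3# = 2# + 1#

  private
    p∣q : p ∣ q
    p∣q = p∣pʲ k q≡pᵏ
      where
      p∣pʲ : ∀ j → q ≡ p ℕ.^ j → p ∣ q
      p∣pʲ (suc j) q≡pʲ⁺¹ = divides (p ℕ.^ j) (≡.trans q≡pʲ⁺¹ (ℕ.*-comm p _))

  open PrimeCharacteristic F p-prime
    (card≡pʲ⇒p×1≈0 {p} {k ℕ.+ k} (≡.trans (≡.cong₂ ℕ._*_ q≡pᵏ q≡pᵏ) (≡.sym (ℕ.^-distribˡ-+-* p k k))))

  prime×1≈0⇔∣q : ∀ {n} → Prime n → n × 1# ≈ 0# ⇔ n ∣ q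
  prime×1≈0⇔∣q n-prime = mk⇔
    (λ n×1≈0 → ≡.subst (_∣ q) (≡.sym (prime×1≈0⇒≡p 1≉0 n-prime n×1≈0)) p∣q)
    (λ n∣q → ≡.subst (λ n → n × 1# ≈ 0#)
               (≡.sym (prime∣prime⇒≡ n-prime p-prime (prime∣^⇒∣ k n-prime (≡.subst (_ ∣_) q≡pᵏ n∣q))))
               (∣⇒×≈0 1# ∣-refl))

  2≉0 : 2# ≉ 0#
  2≉0 2≈0 = contradiction (≡.trans (≡.sym (n∣m⇒m%n≡0 q 2 2∣q)) q-odd) λ ()
    where
    2∣q : 2 ∣ q
    2∣q = Equivalence.to (prime×1≈0⇔∣q prime[2]) (trans (×ᵤ≈× 2 1#) 2≈0)

  3≈0⇔3∣q : 3# ≈ 0# ⇔ 3 ∣ q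
  3≈0⇔3∣q = mk⇔
    (λ 3≈0 → Equivalence.to 3×1≈0⇔3∣q (trans 3×1≈3 3≈0))
    (λ 3∣q → trans (sym 3×1≈3) (Equivalence.from 3×1≈0⇔3∣q 3∣q))
    where
    3×1≈0⇔3∣q = prime×1≈0⇔∣q (toWitness {a? = prime? 3} _)
    3×1≈3 : 3 × 1# ≈ 3#
    3×1≈3 = ×ᵤ≈× 3 1#

  φ : Carrier → Carrier
  φ x = x ^ q

  φ-cong : ∀ {x y} → x ≈ y → φ x ≈ φ y
  φ-cong = ^-congˡ q

  φ-+ : ∀ x y → φ (x + y) ≈ φ x + φ y
  φ-+ x y = ≡.subst (λ n → (x + y) ^ n ≈ x ^ n + y ^ n) (≡.sym q≡pᵏ) (^[p^k]-homo-+ k x y)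

  φ-* : ∀ x y → φ (x * y) ≈ φ x * φ y
  φ-* x y = ^-distrib-* x y q

  φ-0 : φ 0# ≈ 0#
  φ-0 = zeroˡ _

  private
    1^n≈1 : ∀ n → 1# ^ n ≈ 1#
    1^n≈1 zero = refl
    1^n≈1 (suc n) = trans (*-identityˡ _) (1^n≈1 n)

  φ-1 : φ 1# ≈ 1#
  φ-1 = 1^n≈1 q

  φ-‿ : ∀ x → φ (- x) ≈ - φ x
  φ-‿ x = +-inverseʳ-unique (φ x) (φ (- x)) (trans (sym (φ-+ x (- x))) (trans (φ-cong (-‿inverseʳ x)) φ-0))

  φ-− : ∀ x y → φ (x - y) ≈ φ x - φ y
  φ-− x y = trans (φ-+ x (- y)) (+-congˡ (φ-‿ y))

  φ-^ : ∀ x n → φ (x ^ n) ≈ φ x ^ n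
  φ-^ x zero = φ-1
  φ-^ x (suc n) = trans (φ-* x (x ^ n)) (*-congˡ (φ-^ x n))

  φ-involutive : ∀ x → φ (φ x) ≈ x
  φ-involutive x = trans (^-assocʳ x q q) (x^[1+m]≈x x)

  Fixed TraceZero : Carrier → Set ℓ
  Fixed x = φ x ≈ x
  TraceZero x = φ x ≈ - x

  fixed-+ : ∀ {x y} → Fixed x → Fixed y → Fixed (x + y)
  fixed-+ {x} {y} φx≈x φy≈y = trans (φ-+ x y) (+-cong φx≈x φy≈y)

  fixed-* : ∀ {x y} → Fixed x → Fixed y → Fixed (x * y)
  fixed-* {x} {y} φx≈x φy≈y = trans (φ-* x y) (*-cong φx≈x φy≈y)

  fixed-‿ : ∀ {x} → Fixed x → Fixed (- x)
  fixed-‿ {x} φx≈x = trans (φ-‿ x) (-‿cong φx≈x)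

  fixed-− : ∀ {x y} → Fixed x → Fixed y → Fixed (x - y)
  fixed-− φx≈x φy≈y = fixed-+ φx≈x (fixed-‿ φy≈y)

  fixed-2 : Fixed 2#
  fixed-2 = fixed-+ φ-1 φ-1

  traceZero-+ : ∀ {x y} → TraceZero x → TraceZero y → TraceZero (x + y)
  traceZero-+ {x} {y} φx≈-x φy≈-y = trans (φ-+ x y) (trans (+-cong φx≈-x φy≈-y) (-‿+-comm x y))

  traceZero-− : ∀ {x y} → TraceZero x → TraceZero y → TraceZero (x - y)
  traceZero-− {x} {y} φx≈-x φy≈-y = trans (φ-− x y) (trans (+-cong φx≈-x (-‿cong φy≈-y))
    (solve 2 (λ x y → :- x :- :- y := :- (x :- y)) refl x y))

  fixed*traceZero : ∀ {x y} → Fixed x → TraceZero y → TraceZero (x * y)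
  fixed*traceZero {x} {y} φx≈x φy≈-y = trans (φ-* x y) (trans (*-cong φx≈x φy≈-y) (sym (-‿distribʳ-* x y)))

  traceZero*fixed : ∀ {x y} → TraceZero x → Fixed y → TraceZero (x * y)
  traceZero*fixed {x} {y} φx≈-x φy≈y = trans (φ-cong (*-comm x y)) (trans (fixed*traceZero φy≈y φx≈-x) (-‿cong (*-comm y x)))

  fixed-resp : ∀ {x y} → x ≈ y → Fixed y → Fixed x
  fixed-resp x≈y φy≈y = trans (φ-cong x≈y) (trans φy≈y (sym x≈y))

  traceZero*traceZero : ∀ {x y} → TraceZero x → TraceZero y → Fixed (x * y)
  traceZero*traceZero {x} {y} φx≈-x φy≈-y = trans (φ-* x y) (trans (*-cong φx≈-x φy≈-y)
    (solve 2 (λ x y → (:- x) :* (:- y) := x :* y) refl x y))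

  φ-inverse : ∀ {x} (x≉0 : x ≉ 0#) → φ x * φ (inverse x x≉0) ≈ 1#
  φ-inverse {x} x≉0 = trans (sym (φ-* x _)) (trans (φ-cong (*-inverseʳ x x≉0)) φ-1)

  fixed-inverse : ∀ {x} (x≉0 : x ≉ 0#) → Fixed x → Fixed (inverse x x≉0)
  fixed-inverse x≉0 φx≈x = inverse-unique x≉0 (trans (*-congʳ (sym φx≈x)) (φ-inverse x≉0))

  traceZero-inverse : ∀ {x} (x≉0 : x ≉ 0#) → TraceZero x → TraceZero (inverse x x≉0)
  traceZero-inverse {x} x≉0 φx≈-x = begin
    φ x⁻¹        ≈⟨ -‿involutive _ ⟨
    - - φ x⁻¹    ≈⟨ -‿cong (inverse-unique x≉0 (begin
      x * - φ x⁻¹      ≈⟨ solve 2 (λ x y → x :* (:- y) := (:- x) :* y) refl x (φ x⁻¹) ⟩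
      - x * φ x⁻¹      ≈⟨ *-congʳ φx≈-x ⟨
      φ x * φ x⁻¹      ≈⟨ φ-inverse x≉0 ⟩
      1#               ∎)) ⟩
    - x⁻¹        ∎
    where x⁻¹ = inverse x x≉0

  fixed∧traceZero⇒≈0 : ∀ {x} → Fixed x → TraceZero x → x ≈ 0#
  fixed∧traceZero⇒≈0 {x} φx≈x φx≈-x = x≉0∧x*y≈0⇒y≈0 2≉0 (begin
    2# * x       ≈⟨ solve 1 (λ x → con (+ 2) :* x := x :+ x) refl x ⟩
    x + x        ≈⟨ +-congˡ (trans (sym φx≈x) φx≈-x) ⟩
    x - x        ≈⟨ -‿inverseʳ x ⟩
    0#           ∎)

  -- (q - 1)(q + 1), the number of nonzero elements
  m : ℕ
  m = suc r ℕ.+ suc r ℕ.* q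

  private
    m≡[1+q]r+[1+q] : ∀ r q → suc r ℕ.+ suc r ℕ.* q ≡ suc q ℕ.* r ℕ.+ suc q
    m≡[1+q]r+[1+q] = solve-∀

    [1+q][1+r]≡m : ∀ r q → suc q ℕ.* suc r ≡ suc r ℕ.+ suc r ℕ.* q
    [1+q][1+r]≡m = solve-∀

  ∃-nonfixed : ∃ λ z → ¬ Fixed z
  ∃-nonfixed =
    let z , z≉0 , zʳ⁺¹≉1 = ∃-x^[1+d]≉1 r (ℕ.m<m+n (suc r) {suc r ℕ.* q} (s≤s z≤n))
    in z , λ φz≈z → zʳ⁺¹≉1 (*-cancelˡ z≉0 (trans φz≈z (sym (*-identityʳ z))))

  ∃-unit-nonfixed : ∃ λ ζ → ζ * φ ζ ≈ 1# ∧ ¬ Fixed ζ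
  ∃-unit-nonfixed =
    let x , x≉0 , x²⁽ʳ⁺¹⁾≉1 = ∃-x^[1+d]≉1 (r ℕ.+ suc r) 2[q-1]<m
        ζ = x ^ suc r
        ζφζ≈1 : ζ * φ ζ ≈ 1#
        ζφζ≈1 = begin
          ζ * (x ^ suc r) ^ q       ≈⟨ *-congˡ (^-assocʳ x (suc r) q) ⟩
          ζ * x ^ (suc r ℕ.* q)     ≈⟨ ^-homo-* x (suc r) (suc r ℕ.* q) ⟨
          x ^ m                     ≈⟨ x^m≈1 x≉0 ⟩
          1#                        ∎
    in ζ , ζφζ≈1 , λ φζ≈ζ → x²⁽ʳ⁺¹⁾≉1 (begin
      x ^ (suc r ℕ.+ suc r)     ≈⟨ ^-homo-* x (suc r) (suc r) ⟩
      ζ * ζ                     ≈⟨ *-congˡ φζ≈ζ ⟨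
      ζ * φ ζ                   ≈⟨ ζφζ≈1 ⟩
      1#                        ∎)
    where
    2[q-1]<m : suc r ℕ.+ suc r < m
    2[q-1]<m = ℕ.+-monoʳ-< (suc r) (ℕ.<-≤-trans (ℕ.n<1+n (suc r)) (ℕ.m≤m+n q (r ℕ.* q)))

  -- If b is not a norm z φ(z) = z ^ (q + 1), every z ≉ 0 is a root of G (z ^ (q + 1)), where
  -- (Y - b) G(Y) = Y ^ (q - 1) - b ^ (q - 1): a monic polynomial of degree (q + 1)(q - 2) < q² - 1.
  ∃-norm : ∀ {b} → Fixed b → b ≉ 0# → ∃ λ a → a * φ a ≈ b
  ∃-norm {b} φb≈b b≉0 = fromDec (Fin.any? (λ i → elem i * φ (elem i) ≟ b))
    where
    open Enumeration allElements
    G = geometric b r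

    deg<m : length (atPower q G) < m
    deg<m = ≡.subst₂ _<_
      (≡.sym (≡.trans (length-atPower q G) (≡.cong (suc q ℕ.*_) (length-geometric b r))))
      (≡.sym (m≡[1+q]r+[1+q] r q)) (ℕ.m<m+n (suc q ℕ.* r) (s≤s z≤n))

    bʳ⁺¹≈1 : b ^ suc r ≈ 1#
    bʳ⁺¹≈1 = *-cancelˡ b≉0 (trans φb≈b (sym (*-identityʳ b)))

    nonNorm-vanishes : ¬ (∃ λ i → elem i * φ (elem i) ≈ b) → ∀ {z} → z ≉ 0# → monic (atPower q G) z ≈ 0#
    nonNorm-vanishes ∄a {z} z≉0 = begin
      monic (atPower q G) z                ≈⟨ monic-atPower q G z ⟩
      monic G y                            ≈⟨ x≉0∧x*y≈0⇒y≈0 y-b≉0 (begin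
        (y - b) * monic G y                   ≈⟨ monic-geometric b r y ⟩
        y ^ suc r - b ^ suc r                 ≈⟨ +-cong yʳ⁺¹≈1 (-‿cong bʳ⁺¹≈1) ⟩
        1# - 1#                               ≈⟨ -‿inverseʳ 1# ⟩
        0#                                    ∎) ⟩
      0#                                   ∎
      where
      y = z ^ suc q
      yʳ⁺¹≈1 : y ^ suc r ≈ 1#
      yʳ⁺¹≈1 = trans (^-assocʳ z (suc q) (suc r)) (trans (reflexive (≡.cong (z ^_) ([1+q][1+r]≡m r q))) (x^m≈1 z≉0))
      y-b≉0 : y - b ≉ 0#
      y-b≉0 y-b≈0 = ∄a (index z _ , trans (*-cong e≈z (φ-cong e≈z)) (x∙y⁻¹≈ε⇒x≈y y b y-b≈0))
        where e≈z = elem-index z _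

    fromDec : Dec (∃ λ i → elem i * φ (elem i) ≈ b) → ∃ λ a → a * φ a ≈ b
    fromDec (yes (i , norm≈b)) = elem i , norm≈b
    fromDec (no ∄a) = let z , z≉0 , nonroot = ∃-nonroot (atPower q G) deg<m
                      in contradiction (nonNorm-vanishes ∄a z≉0) nonroot

  PrimitiveCubeRoot : Carrier → Set ℓ
  PrimitiveCubeRoot ω = 1# + ω + ω * ω ≈ 0#

  primitiveCubeRoot^3≈1 : ∀ {ω} → PrimitiveCubeRoot ω → ω ^ 3 ≈ 1#
  primitiveCubeRoot^3≈1 {ω} ω-root = x∙y⁻¹≈ε⇒x≈y _ _ (begin
    ω ^ 3 - 1#                       ≈⟨ solve 1 (λ ω → ω :^ 3 :- con (+ 1) := (ω :- con (+ 1)) :* (con (+ 1) :+ ω :+ ω :* ω)) refl ω ⟩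
    (ω - 1#) * (1# + ω + ω * ω)      ≈⟨ *-congˡ ω-root ⟩
    (ω - 1#) * 0#                    ≈⟨ zeroʳ _ ⟩
    0#                               ∎)

  primitiveCubeRoot≉0 : ∀ {ω} → PrimitiveCubeRoot ω → ω ≉ 0#
  primitiveCubeRoot≉0 {ω} ω-root ω≈0 = 1≉0 (begin
    1#                     ≈⟨ solve 1 (λ ω → con (+ 1) := (con (+ 1) :+ ω :+ ω :* ω) :- ω :* (con (+ 1) :+ ω)) refl ω ⟩
    (1# + ω + ω * ω) - ω * (1# + ω)  ≈⟨ +-cong ω-root (-‿cong (trans (*-congʳ ω≈0) (zeroˡ _))) ⟩
    0# - 0#                ≈⟨ -‿inverseʳ 0# ⟩
    0#                     ∎)

  x^3≈1⇒x^n≈x^[n%3] : ∀ {x} → x ^ 3 ≈ 1# → ∀ n → x ^ n ≈ x ^ (n % 3)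
  x^3≈1⇒x^n≈x^[n%3] {x} x³≈1 n = begin
    x ^ n                               ≡⟨ ≡.cong (x ^_) (m≡m%n+[m/n]*n n 3) ⟩
    x ^ (n % 3 ℕ.+ n / 3 ℕ.* 3)         ≈⟨ ^-homo-* x (n % 3) _ ⟩
    x ^ (n % 3) * x ^ (n / 3 ℕ.* 3)     ≡⟨ ≡.cong (λ j → x ^ (n % 3) * x ^ j) (ℕ.*-comm (n / 3) 3) ⟩
    x ^ (n % 3) * x ^ (3 ℕ.* (n / 3))   ≈⟨ *-congˡ (^-assocʳ x 3 (n / 3)) ⟨
    x ^ (n % 3) * (x ^ 3) ^ (n / 3)     ≈⟨ *-congˡ (trans (^-congˡ (n / 3) x³≈1) (1^n≈1 (n / 3))) ⟩
    x ^ (n % 3) * 1#                    ≈⟨ *-identityʳ _ ⟩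
    x ^ (n % 3)                         ∎

  ∃-primitiveCubeRoot : 3# ≉ 0# → ∃ PrimitiveCubeRoot
  ∃-primitiveCubeRoot 3≉0 =
    let divides t m≡t*3 = 3∤n∧1+m≡n*n⇒3∣m (3≉0 ∘ Equivalence.from 3≈0⇔3∣q) ≡.refl
    in cubeRoot t m≡t*3
    where
    cubeRoot : ∀ t → m ≡ t ℕ.* 3 → ∃ PrimitiveCubeRoot
    cubeRoot (suc d) m≡t*3 =
      let z , z≉0 , zᵗ≉1 = ∃-x^[1+d]≉1 d (≡.subst (suc d <_) (≡.sym m≡t*3) (ℕ.m<m*n (suc d) 3 (s≤s (s≤s z≤n))))
          ω = z ^ suc d
          ω³≈1 : ω ^ 3 ≈ 1#
          ω³≈1 = trans (^-assocʳ z (suc d) 3) (trans (reflexive (≡.cong (z ^_) (≡.sym m≡t*3))) (x^m≈1 z≉0))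
      in ω , x≉0∧x*y≈0⇒y≈0 (λ ω-1≈0 → zᵗ≉1 (x∙y⁻¹≈ε⇒x≈y ω 1# ω-1≈0)) (begin
           (ω - 1#) * (1# + ω + ω * ω)  ≈⟨ solve 1 (λ ω → (ω :- con (+ 1)) :* (con (+ 1) :+ ω :+ ω :* ω) := ω :^ 3 :- con (+ 1)) refl ω ⟩
           ω ^ 3 - 1#                   ≈⟨ x≈y⇒x∙y⁻¹≈ε ω³≈1 ⟩
           0#                           ∎)

  eisenstein : Carrier → Carrier → Carrier
  eisenstein u w = u * u + u * w + w * w

  NoOffDiagonal : Carrier → Set (c ⊔ ℓ)
  NoOffDiagonal a = ∀ {u w} → TraceZero u → TraceZero w → eisenstein u w ≈ a * a → u ≈ w

  noOffDiagonal-resp : ∀ {a b} → a ≈ b → NoOffDiagonal b → NoOffDiagonal a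
  noOffDiagonal-resp a≈b noOffDiagonal tzu tzw E≈a² = noOffDiagonal tzu tzw (trans E≈a² (*-cong a≈b a≈b))

  noOffDiagonal-char3 : ∀ {a} → 3# ≈ 0# → Fixed a → NoOffDiagonal a
  noOffDiagonal-char3 {a} 3≈0 φa≈a {u} {w} tzu tzw E≈a² =
    x∙y⁻¹≈ε⇒x≈y u w (fixed∧traceZero⇒≈0 d-fixed (traceZero-− tzu tzw))
    where
    d = u - w
    [d-a][d+a]≈0 : (d - a) * (d + a) ≈ 0#
    [d-a][d+a]≈0 = begin
      (d - a) * (d + a)                      ≈⟨ +-identityʳ _ ⟨
      (d - a) * (d + a) + 0#                 ≈⟨ +-congˡ (trans (*-congʳ 3≈0) (zeroˡ (u * w))) ⟨
      (d - a) * (d + a) + 3# * (u * w)       ≈⟨ solve 3 (λ u w a → ((u :- w) :- a) :* ((u :- w) :+ a) :+ con (+ 3) :* (u :* w)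
                                                     := (u :* u :+ u :* w :+ w :* w) :- a :* a) refl u w a ⟩
      eisenstein u w - a * a                 ≈⟨ x≈y⇒x∙y⁻¹≈ε E≈a² ⟩
      0#                                     ∎
    d-fixed : Fixed d
    d-fixed = [ (λ d-a≈0 → fixed-resp (x∙y⁻¹≈ε⇒x≈y d a d-a≈0) φa≈a)
              , (λ d+a≈0 → fixed-resp (+-inverseˡ-unique d a d+a≈0) (fixed-‿ φa≈a)) ]′
              (x*y≈0⇒x≈0⊎y≈0 [d-a][d+a]≈0)

  traceZero-cube-injective : q % 3 ≡ 2 → ∀ {u w} → TraceZero u → TraceZero w → u ^ 3 ≈ w ^ 3 → u ≈ w
  traceZero-cube-injective q%3≡2 {u} {w} tzu tzw u³≈w³ = fromDec (w ≟ 0#)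
    where
    fromDec : Dec (w ≈ 0#) → u ≈ w
    fromDec (yes w≈0) = trans (x^n≈0⇒x≈0 3 (trans u³≈w³ (trans (^-congˡ 3 w≈0) (zeroˡ _)))) (sym w≈0)
    fromDec (no w≉0) = begin
      u                       ≈⟨ *-identityʳ u ⟨
      u * 1#                  ≈⟨ *-congˡ (*-inverseˡ w w≉0) ⟨
      u * (w⁻¹ * w)           ≈⟨ *-assoc u w⁻¹ w ⟨
      z * w                   ≈⟨ *-congʳ z≈1 ⟩
      1# * w                  ≈⟨ *-identityˡ w ⟩
      w                       ∎
      where
      w⁻¹ = inverse w w≉0
      z = u * w⁻¹
      z³≈1 : z ^ 3 ≈ 1#
      z³≈1 = begin
        z ^ 3                  ≈⟨ ^-distrib-* u w⁻¹ 3 ⟩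
        u ^ 3 * w⁻¹ ^ 3        ≈⟨ *-congʳ u³≈w³ ⟩
        w ^ 3 * w⁻¹ ^ 3        ≈⟨ ^-distrib-* w w⁻¹ 3 ⟨
        (w * w⁻¹) ^ 3          ≈⟨ ^-congˡ 3 (*-inverseʳ w w≉0) ⟩
        1# ^ 3                 ≈⟨ 1^n≈1 3 ⟩
        1#                     ∎
      z≈1 : z ≈ 1#
      z≈1 = *-cancelˡ (λ z≈0 → 1≉0 (trans (sym z³≈1) (trans (^-congˡ 3 z≈0) (zeroˡ _)))) (begin
        z * z                  ≈⟨ *-congˡ (*-identityʳ z) ⟨
        z ^ 2                  ≡⟨ ≡.cong (z ^_) q%3≡2 ⟨
        z ^ (q % 3)            ≈⟨ x^3≈1⇒x^n≈x^[n%3] z³≈1 q ⟨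
        φ z                    ≈⟨ traceZero*traceZero tzu (traceZero-inverse w≉0 tzw) ⟩
        z                      ≈⟨ *-identityʳ z ⟨
        z * 1#                 ∎)

  noOffDiagonal-0 : q % 3 ≡ 2 → NoOffDiagonal 0#
  noOffDiagonal-0 q%3≡2 {u} {w} tzu tzw E≈0 = traceZero-cube-injective q%3≡2 tzu tzw (x∙y⁻¹≈ε⇒x≈y _ _ (begin
    u ^ 3 - w ^ 3                ≈⟨ solve 2 (λ u w → u :^ 3 :- w :^ 3 := (u :- w) :* (u :* u :+ u :* w :+ w :* w)) refl u w ⟩
    (u - w) * eisenstein u w     ≈⟨ *-congˡ (trans E≈0 (zeroˡ 0#)) ⟩
    (u - w) * 0#                 ≈⟨ zeroʳ _ ⟩
    0#                           ∎))

  module EisensteinFactorisation {ω} (ω-root : PrimitiveCubeRoot ω) (3≉0 : 3# ≉ 0#) (A B : Carrier) where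

    D : Carrier
    D = ω * ω - ω

    D≉0 : D ≉ 0#
    D≉0 D≈0 = *-≉0 (primitiveCubeRoot≉0 ω-root) ω-1≉0 (trans (solve 1 (λ ω → ω :* (ω :- con (+ 1)) := ω :* ω :- ω) refl ω) D≈0)
      where
      ω-1≉0 : ω - 1# ≉ 0#
      ω-1≉0 ω-1≈0 = 3≉0 (begin
        3#                       ≈⟨ solve 1 (λ ω → con (+ 3) := (con (+ 1) :+ ω :+ ω :* ω) :- (ω :- con (+ 1)) :* (ω :+ con (+ 2))) refl ω ⟩
        (1# + ω + ω * ω) - (ω - 1#) * (ω + 2#)   ≈⟨ +-cong ω-root (-‿cong (trans (*-congʳ ω-1≈0) (zeroˡ _))) ⟩
        0# - 0#                  ≈⟨ -‿inverseʳ 0# ⟩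
        0#                       ∎)

    w u : Carrier
    w = inverse D D≉0 * (A - B)
    u = A + ω * w

    Dw≈A-B : D * w ≈ A - B
    Dw≈A-B = trans (sym (*-assoc _ _ _)) (trans (*-congʳ (*-inverseʳ D D≉0)) (*-identityˡ _))

    u-ωw≈A : u - ω * w ≈ A
    u-ωw≈A = solve 3 (λ A ω w → (A :+ ω :* w) :- ω :* w := A) refl A ω w

    u-ω²w≈B : u - ω * ω * w ≈ B
    u-ω²w≈B = begin
      u - ω * ω * w          ≈⟨ solve 3 (λ A ω w → (A :+ ω :* w) :- ω :* ω :* w := A :- (ω :* ω :- ω) :* w) refl A ω w ⟩
      A - D * w              ≈⟨ +-congˡ (-‿cong Dw≈A-B) ⟩
      A - (A - B)            ≈⟨ solve 2 (λ A B → A :- (A :- B) := B) refl A B ⟩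
      B                      ∎

    eisenstein≈AB : eisenstein u w ≈ A * B
    eisenstein≈AB = begin
      eisenstein u w
        ≈⟨ solve 3 (λ u w ω → u :* u :+ u :* w :+ w :* w
                        := (u :- ω :* w) :* (u :- ω :* ω :* w) :+ (con (+ 1) :+ ω :+ ω :* ω) :* (u :* w :+ (con (+ 1) :- ω) :* (w :* w))) refl u w ω ⟩
      (u - ω * w) * (u - ω * ω * w) + (1# + ω + ω * ω) * (u * w + (1# - ω) * (w * w))
        ≈⟨ +-cong (*-cong u-ωw≈A u-ω²w≈B) (*-congʳ ω-root) ⟩
      A * B + 0# * (u * w + (1# - ω) * (w * w))   ≈⟨ trans (+-congˡ (zeroˡ _)) (+-identityʳ _) ⟩
      A * B                  ∎

    u≈w⇒B+ω²A≈0 : u ≈ w → B + ω * ω * A ≈ 0#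
    u≈w⇒B+ω²A≈0 u≈w = begin
      B + ω * ω * A
        ≈⟨ +-cong u-ω²w≈B (*-congˡ u-ωw≈A) ⟨
      (u - ω * ω * w) + ω * ω * (u - ω * w)
        ≈⟨ solve 3 (λ u w ω → (u :- ω :* ω :* w) :+ ω :* ω :* (u :- ω :* w)
                        := (u :- w) :* (con (+ 1) :+ ω :* ω) :+ w :* ((con (+ 1) :- ω) :* (con (+ 1) :+ ω :+ ω :* ω))) refl u w ω ⟩
      (u - w) * (1# + ω * ω) + w * ((1# - ω) * (1# + ω + ω * ω))
        ≈⟨ +-cong (*-congʳ (x≈y⇒x∙y⁻¹≈ε u≈w)) (*-congˡ (*-congˡ ω-root)) ⟩
      0# * (1# + ω * ω) + w * ((1# - ω) * 0#)
        ≈⟨ trans (+-cong (zeroˡ _) (trans (*-congˡ (zeroʳ _)) (zeroʳ _))) (+-identityʳ _) ⟩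
      0#                     ∎

  private
    q%3≡1+j⇒3≉0 : ∀ {j} → q % 3 ≡ suc j → 3# ≉ 0#
    q%3≡1+j⇒3≉0 q%3≡1+j 3≈0 = contradiction (≡.trans (≡.sym (n∣m⇒m%n≡0 q 3 (Equivalence.to 3≈0⇔3∣q 3≈0))) q%3≡1+j) λ ()

    φω≈ω^[q%3] : ∀ {ω} → PrimitiveCubeRoot ω → φ ω ≈ ω ^ (q % 3)
    φω≈ω^[q%3] ω-root = x^3≈1⇒x^n≈x^[n%3] (primitiveCubeRoot^3≈1 ω-root) q

  offDiagonal-fixedRoot : ∀ {a ω A} → Fixed a → PrimitiveCubeRoot ω → Fixed ω → 3# ≉ 0# →
                          TraceZero A → (A≉0 : A ≉ 0#) → a * a + ω * ω * (A * A) ≉ 0# → ¬ NoOffDiagonal a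
  offDiagonal-fixedRoot {a} {ω} {A} φa≈a ω-root φω≈ω 3≉0 tzA A≉0 a²+ω²A²≉0 noOffDiagonal =
    B+ω²A≉0 (u≈w⇒B+ω²A≈0 (noOffDiagonal tzu tzw (trans eisenstein≈AB AB≈a²)))
    where
    B = (a * a) * inverse A A≉0
    open EisensteinFactorisation ω-root 3≉0 A B
    tzB : TraceZero B
    tzB = fixed*traceZero (fixed-* φa≈a φa≈a) (traceZero-inverse A≉0 tzA)
    tzw : TraceZero w
    tzw = fixed*traceZero (fixed-inverse D≉0 (fixed-− (fixed-* φω≈ω φω≈ω) φω≈ω)) (traceZero-− tzA tzB)
    tzu : TraceZero u
    tzu = traceZero-+ tzA (fixed*traceZero φω≈ω tzw)
    AB≈a² : A * B ≈ a * a
    AB≈a² = begin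
      A * ((a * a) * inverse A A≉0)   ≈⟨ solve 3 (λ A s i → A :* (s :* i) := s :* (A :* i)) refl A (a * a) (inverse A A≉0) ⟩
      (a * a) * (A * inverse A A≉0)   ≈⟨ *-congˡ (*-inverseʳ A A≉0) ⟩
      (a * a) * 1#                    ≈⟨ *-identityʳ _ ⟩
      a * a                           ∎
    B+ω²A≉0 : B + ω * ω * A ≉ 0#
    B+ω²A≉0 B+ω²A≈0 = a²+ω²A²≉0 (begin
      a * a + ω * ω * (A * A)         ≈⟨ solve 4 (λ A B s ω → s :+ ω :* ω :* (A :* A) := (s :- A :* B) :+ A :* (B :+ ω :* ω :* A)) refl A B (a * a) ω ⟩
      (a * a - A * B) + A * (B + ω * ω * A)   ≈⟨ +-cong (x≈y⇒x∙y⁻¹≈ε (sym AB≈a²)) (trans (*-congˡ B+ω²A≈0) (zeroʳ A)) ⟩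
      0# + 0#                         ≈⟨ +-identityʳ 0# ⟩
      0#                              ∎)

  ¬noOffDiagonal-q≡1 : q % 3 ≡ 1 → ∀ {a} → Fixed a → ¬ NoOffDiagonal a
  ¬noOffDiagonal-q≡1 q%3≡1 {a} φa≈a =
    let ω , ω-root = ∃-primitiveCubeRoot (q%3≡1+j⇒3≉0 q%3≡1)
        z , φz≉z = ∃-nonfixed
        φω≈ω : Fixed ω
        φω≈ω = trans (φω≈ω^[q%3] ω-root) (trans (reflexive (≡.cong (ω ^_) q%3≡1)) (*-identityʳ ω))
        A = φ z - z
        tzA : TraceZero A
        tzA = trans (φ-− (φ z) z) (trans (+-congʳ (φ-involutive z)) (solve 2 (λ z y → z :- y := :- (y :- z)) refl z (φ z)))
        A≉0 : A ≉ 0#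
        A≉0 A≈0 = φz≉z (x∙y⁻¹≈ε⇒x≈y (φ z) z A≈0)
    in fromDec ω-root φω≈ω tzA A≉0 (a * a + ω * ω * (A * A) ≟ 0#)
    where
    3≉0 = q%3≡1+j⇒3≉0 q%3≡1
    fromDec : ∀ {ω A} → PrimitiveCubeRoot ω → Fixed ω → TraceZero A → (A≉0 : A ≉ 0#) →
              Dec (a * a + ω * ω * (A * A) ≈ 0#) → ¬ NoOffDiagonal a
    fromDec ω-root φω≈ω tzA A≉0 (no a²+ω²A²≉0) = offDiagonal-fixedRoot φa≈a ω-root φω≈ω 3≉0 tzA A≉0 a²+ω²A²≉0
    -- if A fails then 2 A does not: the two values of a² + ω² A² differ by 3 ω² A² ≉ 0
    fromDec {ω} {A} ω-root φω≈ω tzA A≉0 (yes a²+ω²A²≈0) =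
      offDiagonal-fixedRoot φa≈a ω-root φω≈ω 3≉0 (fixed*traceZero fixed-2 tzA) (*-≉0 2≉0 A≉0) (λ a²+ω²[2A]²≈0 →
        *-≉0 3≉0 (*-≉0 (*-≉0 ω≉0 ω≉0) (*-≉0 A≉0 A≉0)) (begin
          3# * (ω * ω * (A * A))
            ≈⟨ solve 3 (λ a ω A → con (+ 3) :* (ω :* ω :* (A :* A))
                 := (a :* a :+ ω :* ω :* ((con (+ 2) :* A) :* (con (+ 2) :* A))) :- (a :* a :+ ω :* ω :* (A :* A))) refl a ω A ⟩
          (a * a + ω * ω * ((2# * A) * (2# * A))) - (a * a + ω * ω * (A * A))
            ≈⟨ +-cong a²+ω²[2A]²≈0 (-‿cong a²+ω²A²≈0) ⟩
          0# - 0#   ≈⟨ -‿inverseʳ 0# ⟩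
          0#        ∎))
      where ω≉0 = primitiveCubeRoot≉0 ω-root

  offDiagonal-conjugateRoot : ∀ {a ω A} → PrimitiveCubeRoot ω → φ ω ≈ ω * ω → 3# ≉ 0# →
                              A * φ A ≈ - (a * a) → φ A ≉ ω * ω * A → ¬ NoOffDiagonal a
  offDiagonal-conjugateRoot {a} {ω} {A} ω-root φω≈ω² 3≉0 AφA≈-a² φA≉ω²A noOffDiagonal =
    B+ω²A≉0 (u≈w⇒B+ω²A≈0 (noOffDiagonal tzu tzw (trans eisenstein≈AB AB≈a²)))
    where
    B = - φ A
    open EisensteinFactorisation ω-root 3≉0 A B
    tzD : TraceZero D
    tzD = begin
      φ (ω * ω - ω)                 ≈⟨ trans (φ-− _ ω) (+-congʳ (φ-* ω ω)) ⟩
      φ ω * φ ω - φ ω               ≈⟨ +-cong (*-cong φω≈ω² φω≈ω²) (-‿cong φω≈ω²) ⟩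
      (ω * ω) * (ω * ω) - ω * ω     ≈⟨ +-congʳ (trans (solve 1 (λ ω → (ω :* ω) :* (ω :* ω) := ω :^ 3 :* ω) refl ω)
                                         (trans (*-congʳ (primitiveCubeRoot^3≈1 ω-root)) (*-identityˡ ω))) ⟩
      ω - ω * ω                     ≈⟨ solve 1 (λ ω → ω :- ω :* ω := :- (ω :* ω :- ω)) refl ω ⟩
      - (ω * ω - ω)                 ∎
    A-B-fixed : Fixed (A - B)
    A-B-fixed = fixed-resp (+-congˡ (-‿involutive (φ A)))
                  (trans (φ-+ A (φ A)) (trans (+-congˡ (φ-involutive A)) (+-comm _ _)))
    tzw : TraceZero w
    tzw = traceZero*fixed (traceZero-inverse D≉0 tzD) A-B-fixed
    tzu : TraceZero u
    tzu = begin
      φ (A + ω * w)                  ≈⟨ trans (φ-+ A _) (+-congˡ (trans (φ-* ω w) (*-cong φω≈ω² tzw))) ⟩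
      φ A + ω * ω * - w              ≈⟨ solve 4 (λ P A ω w → P :+ ω :* ω :* (:- w)
                                               := :- (A :+ ω :* w) :+ ((A :- :- P) :- (ω :* ω :- ω) :* w)) refl (φ A) A ω w ⟩
      - u + ((A - B) - D * w)        ≈⟨ +-congˡ (x≈y⇒x∙y⁻¹≈ε (sym Dw≈A-B)) ⟩
      - u + 0#                       ≈⟨ +-identityʳ _ ⟩
      - u                            ∎
    AB≈a² : A * B ≈ a * a
    AB≈a² = trans (sym (-‿distribʳ-* A (φ A))) (trans (-‿cong AφA≈-a²) (-‿involutive _))
    B+ω²A≉0 : B + ω * ω * A ≉ 0#
    B+ω²A≉0 B+ω²A≈0 = φA≉ω²A (sym (trans (+-inverseˡ-unique (ω * ω * A) B (trans (+-comm _ _) B+ω²A≈0)) (-‿involutive (φ A))))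

  ¬noOffDiagonal-q≡2 : q % 3 ≡ 2 → ∀ {a} → Fixed a → a ≉ 0# → ¬ NoOffDiagonal a
  ¬noOffDiagonal-q≡2 q%3≡2 {a} φa≈a a≉0 =
    let ω , ω-root = ∃-primitiveCubeRoot (q%3≡1+j⇒3≉0 q%3≡2)
        φω≈ω² : φ ω ≈ ω * ω
        φω≈ω² = trans (φω≈ω^[q%3] ω-root) (trans (reflexive (≡.cong (ω ^_) q%3≡2)) (*-congˡ (*-identityʳ ω)))
        A , AφA≈b = ∃-norm (fixed-‿ (fixed-* φa≈a φa≈a)) b≉0
    in fromDec ω-root φω≈ω² AφA≈b (φ A ≟ ω * ω * A)
    where
    3≉0 = q%3≡1+j⇒3≉0 q%3≡2
    b = - (a * a)
    b≉0 : b ≉ 0#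
    b≉0 b≈0 = *-≉0 a≉0 a≉0 (trans (sym (-‿involutive (a * a))) (trans (-‿cong b≈0) -0#≈0#))
    fromDec : ∀ {ω A} → PrimitiveCubeRoot ω → φ ω ≈ ω * ω → A * φ A ≈ b →
              Dec (φ A ≈ ω * ω * A) → ¬ NoOffDiagonal a
    fromDec ω-root φω≈ω² AφA≈b (no φA≉ω²A) = offDiagonal-conjugateRoot ω-root φω≈ω² 3≉0 AφA≈b φA≉ω²A
    -- a unit ζ with φ ζ ≉ ζ keeps the norm of A and moves φ A away from ω² A
    fromDec {ω} {A} ω-root φω≈ω² AφA≈b (yes φA≈ω²A) =
      let ζ , ζφζ≈1 , φζ≉ζ = ∃-unit-nonfixed
          AζφAζ≈b : (A * ζ) * φ (A * ζ) ≈ b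
          AζφAζ≈b = begin
            (A * ζ) * φ (A * ζ)       ≈⟨ *-congˡ (φ-* A ζ) ⟩
            (A * ζ) * (φ A * φ ζ)     ≈⟨ solve 4 (λ A ζ P Z → (A :* ζ) :* (P :* Z) := (A :* P) :* (ζ :* Z)) refl A ζ (φ A) (φ ζ) ⟩
            (A * φ A) * (ζ * φ ζ)     ≈⟨ *-cong AφA≈b ζφζ≈1 ⟩
            b * 1#                    ≈⟨ *-identityʳ b ⟩
            b                         ∎
          φAζ≉ω²Aζ : φ (A * ζ) ≉ ω * ω * (A * ζ)
          φAζ≉ω²Aζ φAζ≈ω²Aζ = φζ≉ζ (*-cancelˡ ω²A≉0 (begin
            ω * ω * A * φ ζ           ≈⟨ *-congʳ φA≈ω²A ⟨
            φ A * φ ζ                 ≈⟨ φ-* A ζ ⟨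
            φ (A * ζ)                 ≈⟨ φAζ≈ω²Aζ ⟩
            ω * ω * (A * ζ)           ≈⟨ *-assoc _ A ζ ⟨
            ω * ω * A * ζ             ∎))
      in offDiagonal-conjugateRoot ω-root φω≈ω² 3≉0 AζφAζ≈b φAζ≉ω²Aζ
      where
      ω≉0 = primitiveCubeRoot≉0 ω-root
      A≉0 : A ≉ 0#
      A≉0 A≈0 = b≉0 (trans (sym AφA≈b) (trans (*-congʳ A≈0) (zeroˡ _)))
      ω²A≉0 : ω * ω * A ≉ 0#
      ω²A≉0 = *-≉0 (*-≉0 ω≉0 ω≉0) A≉0

  module PermutationPolynomial (δ γ : Carrier) (γ-fixed : Fixed γ) (γ≉0 : γ ≉ 0#) where

    f : Carrier → Carrier
    f = fPoly F q δ γ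

    T : Carrier
    T = Tr F q δ

    half a ε : Carrier
    half = inverse 2# 2≉0
    a = half * T
    ε = δ - a

    T-fixed : Fixed T
    T-fixed = trans (φ-+ δ (φ δ)) (trans (+-congˡ (φ-involutive δ)) (+-comm _ _))

    half-fixed : Fixed half
    half-fixed = fixed-inverse 2≉0 fixed-2

    a-fixed : Fixed a
    a-fixed = fixed-* half-fixed T-fixed

    2*half≈1 : 2# * half ≈ 1#
    2*half≈1 = *-inverseʳ 2# 2≉0

    2*half-1≈0 : 2# * half - 1# ≈ 0#
    2*half-1≈0 = x≈y⇒x∙y⁻¹≈ε 2*half≈1

    T≈a+a : T ≈ a + a
    T≈a+a = begin
      T                  ≈⟨ *-identityˡ T ⟨
      1# * T             ≈⟨ *-congʳ 2*half≈1 ⟨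
      2# * half * T      ≈⟨ solve 2 (λ h T → con (+ 2) :* h :* T := h :* T :+ h :* T) refl half T ⟩
      a + a              ∎

    T+1≈a+a+1 : T + 1# ≈ a + a + 1#
    T+1≈a+a+1 = +-congʳ T≈a+a

    ε-traceZero : TraceZero ε
    ε-traceZero = begin
      φ (δ - a)                           ≈⟨ trans (φ-− δ a) (+-congˡ (-‿cong a-fixed)) ⟩
      φ δ - a                             ≈⟨ solve 3 (λ d D a → D :- a := :- (d :- a) :+ ((d :+ D) :- (a :+ a))) refl δ (φ δ) a ⟩
      - (δ - a) + (T - (a + a))           ≈⟨ +-congˡ (x≈y⇒x∙y⁻¹≈ε T≈a+a) ⟩
      - (δ - a) + 0#                      ≈⟨ +-identityʳ _ ⟩
      - (δ - a)                           ∎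

    u v : Carrier → Carrier
    u x = φ x - x + ε
    v x = φ x + x

    u-cong : ∀ {x y} → x ≈ y → u x ≈ u y
    u-cong x≈y = +-congʳ (+-cong (φ-cong x≈y) (-‿cong x≈y))

    v-cong : ∀ {x y} → x ≈ y → v x ≈ v y
    v-cong x≈y = +-cong (φ-cong x≈y) x≈y

    u-traceZero : ∀ x → TraceZero (u x)
    u-traceZero x = traceZero-+ φx-x-traceZero ε-traceZero
      where
      φx-x-traceZero : TraceZero (φ x - x)
      φx-x-traceZero = trans (φ-− (φ x) x) (trans (+-congʳ (φ-involutive x))
                         (solve 2 (λ x y → x :- y := :- (y :- x)) refl x (φ x)))

    v-fixed : ∀ x → Fixed (v x)
    v-fixed x = trans (φ-+ (φ x) x) (trans (+-congʳ (φ-involutive x)) (+-comm x (φ x)))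

    point : ∀ {t s} → TraceZero t → Fixed s → ∃ λ x → u x ≈ t ∧ v x ≈ s
    point {t} {s} tzt φs≈s = x , ux≈t , vx≈s
      where
      x = half * (s - t + ε)
      φx≈ : φ x ≈ half * (s - - t + - ε)
      φx≈ = trans (φ-* half _) (*-cong half-fixed (trans (φ-+ _ ε) (+-cong (trans (φ-− s t) (+-cong φs≈s (-‿cong tzt))) ε-traceZero)))
      ux≈t : u x ≈ t
      ux≈t = begin
        φ x - x + ε                                      ≈⟨ +-congʳ (+-congʳ φx≈) ⟩
        half * (s - - t + - ε) - x + ε                   ≈⟨ solve 4 (λ h s t e → h :* (s :- :- t :+ :- e) :- h :* (s :- t :+ e) :+ e
                                                              := t :+ (con (+ 2) :* h :- con (+ 1)) :* (t :- e)) refl half s t ε ⟩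
        t + (2# * half - 1#) * (t - ε)                   ≈⟨ +-congˡ (trans (*-congʳ 2*half-1≈0) (zeroˡ _)) ⟩
        t + 0#                                           ≈⟨ +-identityʳ t ⟩
        t                                                ∎
      vx≈s : v x ≈ s
      vx≈s = begin
        φ x + x                                          ≈⟨ +-congʳ φx≈ ⟩
        half * (s - - t + - ε) + x                       ≈⟨ solve 4 (λ h s t e → h :* (s :- :- t :+ :- e) :+ h :* (s :- t :+ e)
                                                              := s :+ (con (+ 2) :* h :- con (+ 1)) :* s) refl half s t ε ⟩
        s + (2# * half - 1#) * s                         ≈⟨ +-congˡ (trans (*-congʳ 2*half-1≈0) (zeroˡ _)) ⟩
        s + 0#                                           ≈⟨ +-identityʳ s ⟩
        s                                                ∎

    coordinates-injective : ∀ {x y} → u x ≈ u y → v x ≈ v y → x ≈ y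
    coordinates-injective {x} {y} ux≈uy vx≈vy = *-cancelˡ 2≉0 (begin
      2# * x               ≈⟨ 2x≈v-u+ε x ⟩
      v x - (u x - ε)      ≈⟨ +-cong vx≈vy (-‿cong (+-congʳ ux≈uy)) ⟩
      v y - (u y - ε)      ≈⟨ 2x≈v-u+ε y ⟨
      2# * y               ∎)
      where
      2x≈v-u+ε : ∀ x → 2# * x ≈ v x - (u x - ε)
      2x≈v-u+ε x = solve 3 (λ x X e → con (+ 2) :* x := (X :+ x) :- ((X :- x :+ e) :- e)) refl x (φ x) ε

    g : Carrier → Carrier
    g t = (a - t) * (a + t) ^ 3 + (a - t) * (a + t) ^ 2

    g-cong : ∀ {s t} → s ≈ t → g s ≈ g t
    g-cong s≈t = +-cong (*-cong a-s≈a-t (^-congˡ 3 (+-congˡ s≈t))) (*-cong a-s≈a-t (^-congˡ 2 (+-congˡ s≈t)))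
      where a-s≈a-t = +-congˡ (-‿cong s≈t)

    φ-g : ∀ {t} → TraceZero t → φ (g t) ≈ g (- t)
    φ-g {t} tzt = trans (φ-+ _ _) (+-cong (trans (φ-* _ _) (*-cong φ[a-t] (trans (φ-^ _ 3) (^-congˡ 3 φ[a+t]))))
                                             (trans (φ-* _ _) (*-cong φ[a-t] (trans (φ-^ _ 2) (^-congˡ 2 φ[a+t])))))
      where
      φ[a-t] : φ (a - t) ≈ a - - t
      φ[a-t] = trans (φ-− a t) (+-cong a-fixed (-‿cong tzt))
      φ[a+t] : φ (a + t) ≈ a - t
      φ[a+t] = trans (φ-+ a t) (+-cong a-fixed tzt)

    f≈g∘u+γv : ∀ x → f x ≈ g (u x) + γ * v x
    f≈g∘u+γv x = +-congʳ (+-cong (trans (^-homo-* y q 3) (*-cong φy≈a-u (^-congˡ 3 y≈a+u)))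
                                  (trans (^-homo-* y q 2) (*-cong φy≈a-u (^-congˡ 2 y≈a+u))))
      where
      y = φ x - x + δ
      y≈a+u : y ≈ a + u x
      y≈a+u = solve 3 (λ z d a → z :+ d := a :+ (z :+ (d :- a))) refl (φ x - x) δ a
      φy≈a-u : φ y ≈ a - u x
      φy≈a-u = trans (φ-cong y≈a+u) (trans (φ-+ a (u x)) (+-cong a-fixed (u-traceZero x)))

    f-cong : ∀ {x y} → x ≈ y → f x ≈ f y
    f-cong {x} {y} x≈y = trans (f≈g∘u+γv x) (trans (+-cong (g-cong (u-cong x≈y)) (*-congˡ (v-cong x≈y))) (sym (f≈g∘u+γv y)))

    φ∘f≈g∘-u+γv : ∀ x → φ (f x) ≈ g (- u x) + γ * v x
    φ∘f≈g∘-u+γv x = begin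
      φ (f x)                       ≈⟨ φ-cong (f≈g∘u+γv x) ⟩
      φ (g (u x) + γ * v x)         ≈⟨ φ-+ _ _ ⟩
      φ (g (u x)) + φ (γ * v x)     ≈⟨ +-cong (φ-g (u-traceZero x)) (fixed-* γ-fixed (v-fixed x)) ⟩
      g (- u x) + γ * v x           ∎

    h : Carrier → Carrier
    h t = t * t * t - a * a * t

    g-antisymmetry : ∀ t → g (- t) - g t ≈ (a + a + 1#) * (2# * h t)
    g-antisymmetry t = solve 2 (λ a t →
        ((a :- :- t) :* (a :+ :- t) :^ 3 :+ (a :- :- t) :* (a :+ :- t) :^ 2) :- ((a :- t) :* (a :+ t) :^ 3 :+ (a :- t) :* (a :+ t) :^ 2)
      := (a :+ a :+ con (+ 1)) :* (con (+ 2) :* (t :* t :* t :- a :* a :* t))) refl a t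

    h-difference : ∀ s t → h s - h t ≈ (s - t) * (eisenstein s t - a * a)
    h-difference s t = solve 3 (λ s t a → (s :* s :* s :- a :* a :* s) :- (t :* t :* t :- a :* a :* t)
                                        := (s :- t) :* ((s :* s :+ s :* t :+ t :* t) :- a :* a)) refl s t a

    φ∘f-f : ∀ x → φ (f x) - f x ≈ (a + a + 1#) * (2# * h (u x))
    φ∘f-f x = begin
      φ (f x) - f x                                  ≈⟨ +-cong (φ∘f≈g∘-u+γv x) (-‿cong (f≈g∘u+γv x)) ⟩
      (g (- u x) + γ * v x) - (g (u x) + γ * v x)    ≈⟨ solve 3 (λ A B C → (A :+ C) :- (B :+ C) := A :- B) refl (g (- u x)) (g (u x)) (γ * v x) ⟩
      g (- u x) - g (u x)                            ≈⟨ g-antisymmetry (u x) ⟩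
      (a + a + 1#) * (2# * h (u x))                  ∎

    f-injective : T + 1# ≉ 0# → NoOffDiagonal a → Injective _≈_ _≈_ f
    f-injective T+1≉0 noOffDiagonal {x₁} {x₂} fx₁≈fx₂ = coordinates-injective u₁≈u₂ v₁≈v₂
      where
      c≉0 : a + a + 1# ≉ 0#
      c≉0 c≈0 = T+1≉0 (trans T+1≈a+a+1 c≈0)
      h₁≈h₂ : h (u x₁) ≈ h (u x₂)
      h₁≈h₂ = *-cancelˡ 2≉0 (*-cancelˡ c≉0 (begin
        (a + a + 1#) * (2# * h (u x₁))   ≈⟨ φ∘f-f x₁ ⟨
        φ (f x₁) - f x₁                  ≈⟨ +-cong (φ-cong fx₁≈fx₂) (-‿cong fx₁≈fx₂) ⟩
        φ (f x₂) - f x₂                  ≈⟨ φ∘f-f x₂ ⟩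
        (a + a + 1#) * (2# * h (u x₂))   ∎))
      u₁≈u₂ : u x₁ ≈ u x₂
      u₁≈u₂ = [ x∙y⁻¹≈ε⇒x≈y _ _
              , (λ E-a²≈0 → noOffDiagonal (u-traceZero x₁) (u-traceZero x₂) (x∙y⁻¹≈ε⇒x≈y _ _ E-a²≈0)) ]′
              (x*y≈0⇒x≈0⊎y≈0 (trans (sym (h-difference _ _)) (x≈y⇒x∙y⁻¹≈ε h₁≈h₂)))
      v₁≈v₂ : v x₁ ≈ v x₂
      v₁≈v₂ = *-cancelˡ γ≉0 (+-cancelˡ (g (u x₁)) _ _ (begin
        g (u x₁) + γ * v x₁     ≈⟨ f≈g∘u+γv x₁ ⟨
        f x₁                    ≈⟨ fx₁≈fx₂ ⟩
        f x₂                    ≈⟨ f≈g∘u+γv x₂ ⟩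
        g (u x₂) + γ * v x₂     ≈⟨ +-congʳ (g-cong u₁≈u₂) ⟨
        g (u x₁) + γ * v x₂     ∎))

    g-difference-fixed : ∀ {s t} → TraceZero s → TraceZero t → h s ≈ h t → Fixed (g s - g t)
    g-difference-fixed {s} {t} tzs tzt hs≈ht = begin
      φ (g s - g t)                                   ≈⟨ trans (φ-− _ _) (+-cong (φ-g tzs) (-‿cong (φ-g tzt))) ⟩
      g (- s) - g (- t)                               ≈⟨ solve 4 (λ A B C D → A :- B := (C :- D) :+ ((A :- C) :- (B :- D)))
                                                             refl (g (- s)) (g (- t)) (g s) (g t) ⟩
      (g s - g t) + ((g (- s) - g s) - (g (- t) - g t)) ≈⟨ +-congˡ (x≈y⇒x∙y⁻¹≈ε (begin
        g (- s) - g s                  ≈⟨ g-antisymmetry s ⟩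
        (a + a + 1#) * (2# * h s)      ≈⟨ *-congˡ (*-congˡ hs≈ht) ⟩
        (a + a + 1#) * (2# * h t)      ≈⟨ g-antisymmetry t ⟨
        g (- t) - g t                  ∎)) ⟩
      (g s - g t) + 0#                                ≈⟨ +-identityʳ _ ⟩
      g s - g t                                       ∎

    collision : ∀ {s t} → TraceZero s → TraceZero t → h s ≈ h t →
                ∃ λ x₁ → ∃ λ x₂ → u x₁ ≈ s ∧ u x₂ ≈ t ∧ f x₁ ≈ f x₂
    collision {s} {t} tzs tzt hs≈ht =
      let x₁ , ux₁≈s , vx₁≈0 = point tzs φ-0
          x₂ , ux₂≈t , vx₂≈d/γ = point tzt (fixed-* (g-difference-fixed tzs tzt hs≈ht) (fixed-inverse γ≉0 γ-fixed))
      in x₁ , x₂ , ux₁≈s , ux₂≈t , (begin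
        f x₁                                  ≈⟨ f≈g∘u+γv x₁ ⟩
        g (u x₁) + γ * v x₁                   ≈⟨ +-cong (g-cong ux₁≈s) (trans (*-congˡ vx₁≈0) (zeroʳ γ)) ⟩
        g s + 0#                              ≈⟨ +-identityʳ _ ⟩
        g s                                   ≈⟨ solve 2 (λ A B → A := B :+ (A :- B)) refl (g s) (g t) ⟩
        g t + d                               ≈⟨ +-congˡ (trans (*-congˡ (*-inverseʳ γ γ≉0)) (*-identityʳ d)) ⟨
        g t + d * (γ * inverse γ γ≉0)         ≈⟨ +-congˡ (solve 3 (λ g d i → g :* (d :* i) := d :* (g :* i)) refl γ d _) ⟨
        g t + γ * (d * inverse γ γ≉0)         ≈⟨ +-cong (g-cong ux₂≈t) (*-congˡ vx₂≈d/γ) ⟨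
        g (u x₂) + γ * v x₂                   ≈⟨ f≈g∘u+γv x₂ ⟨
        f x₂                                  ∎)
      where d = g s - g t

    injective⇒noOffDiagonal : Injective _≈_ _≈_ f → NoOffDiagonal a
    injective⇒noOffDiagonal f-injective {s} {t} tzs tzt E≈a² =
      let x₁ , x₂ , ux₁≈s , ux₂≈t , fx₁≈fx₂ = collision tzs tzt hs≈ht
      in trans (sym ux₁≈s) (trans (u-cong (f-injective fx₁≈fx₂)) ux₂≈t)
      where
      hs≈ht : h s ≈ h t
      hs≈ht = x∙y⁻¹≈ε⇒x≈y _ _ (trans (h-difference s t) (trans (*-congˡ (x≈y⇒x∙y⁻¹≈ε E≈a²)) (zeroʳ _)))

    T+1≈0⇒¬surjective : T + 1# ≈ 0# → ¬ Surjective _≈_ _≈_ f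
    T+1≈0⇒¬surjective T+1≈0 f-surjective =
      let z , φz≉z = ∃-nonfixed
          x , fx≈z = f-surjective z
      in φz≉z (trans (φ-cong (sym (fx≈z refl))) (trans (f-fixed x) (fx≈z refl)))
      where
      f-fixed : ∀ x → Fixed (f x)
      f-fixed x = x∙y⁻¹≈ε⇒x≈y _ _ (trans (φ∘f-f x) (trans (*-congʳ (trans (sym T+1≈a+a+1) T+1≈0)) (zeroˡ _)))

    isPermutation⇔ : IsPermutation F f ⇔ (T + 1# ≉ 0# ∧ NoOffDiagonal a)
    isPermutation⇔ = mk⇔
      (λ (f-injective , f-surjective) → (λ T+1≈0 → T+1≈0⇒¬surjective T+1≈0 f-surjective) , injective⇒noOffDiagonal f-injective)
      (λ (T+1≉0 , noOffDiagonal) → let f-inj = f-injective T+1≉0 noOffDiagonal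
                                   in f-inj , injective⇒surjective f-cong f-inj)

    classification : (T + 1# ≉ 0# ∧ NoOffDiagonal a) ⇔ ((q % 3 ≡ 0 ∧ T ≉ 2#) ⊎ (q % 3 ≡ 2 ∧ T ≈ 0#))
    classification = mk⇔ (λ (T+1≉0 , noOffDiagonal) → byResidue T+1≉0 noOffDiagonal (q % 3) ≡.refl (m%n<n q 3)) sufficient
      where
      residueTwo : q % 3 ≡ 2 → NoOffDiagonal a → Dec (T ≈ 0#) → (q % 3 ≡ 0 ∧ T ≉ 2#) ⊎ (q % 3 ≡ 2 ∧ T ≈ 0#)
      residueTwo q%3≡2 _ (yes T≈0) = inj₂ (q%3≡2 , T≈0)
      residueTwo q%3≡2 noOffDiagonal (no T≉0) = ⊥-elim (¬noOffDiagonal-q≡2 q%3≡2 a-fixed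
        (λ a≈0 → T≉0 (trans T≈a+a (trans (+-cong a≈0 a≈0) (+-identityʳ 0#)))) noOffDiagonal)

      byResidue : T + 1# ≉ 0# → NoOffDiagonal a → ∀ n → q % 3 ≡ n → n < 3 → (q % 3 ≡ 0 ∧ T ≉ 2#) ⊎ (q % 3 ≡ 2 ∧ T ≈ 0#)
      byResidue T+1≉0 _ 0 q%3≡0 _ =
        inj₁ (q%3≡0 , λ T≈2 → T+1≉0 (trans (+-congʳ T≈2) (Equivalence.from 3≈0⇔3∣q (m%n≡0⇒n∣m q 3 q%3≡0))))
      byResidue _ noOffDiagonal 1 q%3≡1 _ = ⊥-elim (¬noOffDiagonal-q≡1 q%3≡1 a-fixed noOffDiagonal)
      byResidue _ noOffDiagonal 2 q%3≡2 _ = residueTwo q%3≡2 noOffDiagonal (T ≟ 0#)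
      byResidue _ _ (suc (suc (suc _))) _ (s≤s (s≤s (s≤s ())))

      sufficient : (q % 3 ≡ 0 ∧ T ≉ 2#) ⊎ (q % 3 ≡ 2 ∧ T ≈ 0#) → T + 1# ≉ 0# ∧ NoOffDiagonal a
      sufficient (inj₁ (q%3≡0 , T≉2)) = T+1≉0 , noOffDiagonal-char3 3≈0 a-fixed
        where
        3≈0 : 3# ≈ 0#
        3≈0 = Equivalence.from 3≈0⇔3∣q (m%n≡0⇒n∣m q 3 q%3≡0)
        T+1≉0 : T + 1# ≉ 0#
        T+1≉0 T+1≈0 = T≉2 (begin
          T                          ≈⟨ solve 1 (λ T → T := (T :+ con (+ 1)) :+ con (+ 2) :- con (+ 3)) refl T ⟩
          (T + 1#) + 2# - 3#         ≈⟨ +-cong (+-congʳ T+1≈0) (-‿cong 3≈0) ⟩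
          0# + 2# - 0#               ≈⟨ solve 1 (λ x → con (+ 0) :+ x :- con (+ 0) := x) refl 2# ⟩
          2#                         ∎)
      sufficient (inj₂ (q%3≡2 , T≈0)) =
        (λ T+1≈0 → 1≉0 (trans (sym (trans (+-congʳ T≈0) (+-identityˡ 1#))) T+1≈0)) ,
        noOffDiagonal-resp (trans (*-congˡ T≈0) (zeroʳ half)) (noOffDiagonal-0 q%3≡2)

-- imported only here because the development uses _×_ for the multiples n × x
open import Data.Nat using (_*_)
open import Data.Product using (_×_)
open import Function.Construct.Composition using (_⇔-∘_)

theorem3p17 : {c ℓ : Level} (F : CommutativeRing c ℓ) (q : ℕ) →
    IsPrimePower q → q % 2 ≡ 1 → IsFiniteFieldOfOrder F (q * q) →
    (δ γ : CommutativeRing.Carrier F) →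
    InSubfield F q γ → ¬ (CommutativeRing._≈_ F γ (CommutativeRing.0# F)) →
    IsPermutation F (fPoly F q δ γ)
      ⇔ ((q % 3 ≡ 0 × ¬ (CommutativeRing._≈_ F (Tr F q δ) (two F)))
         ⊎ (q % 3 ≡ 2 × CommutativeRing._≈_ F (Tr F q δ) (CommutativeRing.0# F)))
theorem3p17 F 0 _ () _ _ _ _ _
theorem3p17 F 1 (p , suc k , p-prime , _ , 1≡pᵏ⁺¹) _ _ _ _ _ _ =
  contradiction (≡.subst Prime (ℕ.m*n≡1⇒m≡1 p _ (≡.sym 1≡pᵏ⁺¹)) p-prime) ¬prime[1]
theorem3p17 F (suc (suc r)) (p , k , p-prime , _ , q≡pᵏ) q-odd (isField , card) δ γ γ-fixed γ≉0 =
  classification ⇔-∘ isPermutation⇔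
  where
  open QuadraticExtension F isField r {k = k} p-prime q≡pᵏ q-odd card
  open PermutationPolynomial δ γ γ-fixed γ≉0
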